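{- Let $T$ be a spiked tree with $\alpha(T)\ge3$ which is not a spiked star, and let $G$ be a graph. Then an interesting partition $X_1,\dots,X_{\alpha(T)-1}$ of $V(G)$ is $T$-freeness certifying precisely if either (i) $G[X_1]$ and exactly one other $G[X_i]$ are both complements of a matching and every other $G[X_i]$ is a clique, or (ii) $G[X_i]$ is a clique for every $i>1$, and the vertex set of each connected component of the complement of $G[X_1]$ induces in $G$ either a stable set of size three or the disjoint union of a single vertex and the complement of a matching.
   Context: Graphs are finite and simple; $\alpha(\cdot)$ is the stability number. A complement of a matching is a graph whose complement is a matching. A star is a tree in which all but one vertex are leaves. The spiking of a tree $T'$ is obtained from the disjoint union of $T'$ and a stable set with $|V(T')|$ vertices by adding a perfect matching between $V(T')$ and the stable set; a tree is spiked if it is a spiking of some tree; a spiked star is a spiking of a star. An interesting partition of $V(G)$ (with respect to $T$) is a partition $(X_1,\dots,X_{\alpha(T)-1})$ such that $\alpha(G[X_1])\ge\alpha(G[X_j])$ for all $j\ge2$ and each $G[X_i]$ contains either a clique or a stable set of size $|V(T)|$. A $T$-freeness witnessing partition of $G$ is a partition of $V(G)$ into $\alpha(T)-1$ parts $X_1,\dots,X_{\alpha(T)-1}$ such that for every partition $Y_1,\dots,Y_{\alpha(T)-1}$ of $V(T)$ there is an $i$ with $T[Y_i]$ not an induced subgraph of $G[X_i]$. It is $T$-freeness certifying if moreover (i) $\alpha(G[X_1])\ge\alpha(G[X_i])$ for $i\ge2$; (ii) for $i\ge2$, $G[X_i]$ contains a clique of size $|V(T)|$ and $G[X_1]$ contains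 a clique or a stable set of size $|V(T)|$; (iii) each $G[X_i]$ is $P_4$-free. -}

module Defs where

open import Data.Nat using (ℕ; zero; suc; _+_; _≤_)
open import Data.Fin using (Fin; zero; suc; splitAt; inject₁; fromℕ; _≟_)
open import Data.Bool using (Bool; true; false)
open import Data.Sum using (_⊎_; inj₁; inj₂)
open import Data.Product using (Σ; _×_; _,_; ∃)
open import Data.Unit using (⊤)
open import Data.Empty using (⊥)
open import Relation.Nullary using (¬_)
open import Relation.Nullary.Decidable using (⌊_⌋)
open import Relation.Binary.PropositionalEquality using (_≡_; _≢_)
open import Function.Bundles using (_↔_; Inverse)

record Graph : Set where
  field
    n          : ℕ
    adj        : Fin n → Fin n → Bool
    adj-sym    : ∀ u v → adj u v ≡ adj v u
    adj-irrefl : ∀ u → adj u u ≡ false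
open Graph public

Adj : (G : Graph) → Fin (n G) → Fin (n G) → Set
Adj G u v = adj G u v ≡ true

NonAdj : (G : Graph) → Fin (n G) → Fin (n G) → Set
NonAdj G u v = adj G u v ≡ false

VSet : ℕ → Set₁
VSet k = Fin k → Set

full : ∀ {k} → VSet k
full _ = ⊤

Part : ∀ {m k} → (Fin m → Fin k) → Fin k → VSet m
Part p i v = p v ≡ i

HasStable : (G : Graph) → VSet (n G) → ℕ → Set
HasStable G X s =
  Σ (Fin s → Fin (n G)) λ f →
    (∀ i j → f i ≡ f j → i ≡ j) × (∀ i → X (f i)) × (∀ i j → NonAdj G (f i) (f j))

HasClique : (G : Graph) → VSet (n G) → ℕ → Set
HasClique G X s =
  Σ (Fin s → Fin (n G)) λ f →
    (∀ i j → f i ≡ f j → i ≡ j) × (∀ i → X (f i)) × (∀ i j → i ≢ j → Adj G (f i) (f j))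

IsAlpha : (G : Graph) → VSet (n G) → ℕ → Set
IsAlpha G X a = HasStable G X a × (∀ s → HasStable G X s → s ≤ a)

Clique : (G : Graph) → VSet (n G) → Set
Clique G X = ∀ u v → X u → X v → u ≢ v → Adj G u v

-- G[X] is the complement of a matching: every vertex has at most one non-neighbour
CoMatching : (G : Graph) → VSet (n G) → Set
CoMatching G X = ∀ u v w → X u → X v → X w → u ≢ v → u ≢ w →
                 NonAdj G u v → NonAdj G u w → v ≡ w

P4Free : (G : Graph) → VSet (n G) → Set
P4Free G X = ∀ a b c d → X a → X b → X c → X d →
             Adj G a b → Adj G b c → Adj G c d →
             NonAdj G a c → NonAdj G b d → NonAdj G a d → ⊥

Embeds : (G : Graph) → VSet (n G) → (H : Graph) → VSet (n H) → Set
Embeds G A H B =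
  Σ (Fin (n G) → Fin (n H)) λ f →
    (∀ v → A v → B (f v)) ×
    (∀ u v → A u → A v → f u ≡ f v → u ≡ v) ×
    (∀ u v → A u → A v → adj H (f u) (f v) ≡ adj G u v)

data Walk {k : ℕ} (X : VSet k) (R : Fin k → Fin k → Set) : Fin k → Fin k → Set where
  here : ∀ {u} → X u → Walk X R u u
  step : ∀ {u w v} → X u → R u w → Walk X R w v → Walk X R u v

Connected : Graph → Set
Connected G = ∀ u v → Walk full (Adj G) u v

HasCycle : Graph → Set
HasCycle G =
  Σ ℕ λ m → Σ (Fin (3 + m) → Fin (n G)) λ c →
    (∀ i j → c i ≡ c j → i ≡ j) ×
    (∀ (i : Fin (2 + m)) → Adj G (c (inject₁ i)) (c (suc i))) ×
    Adj G (c (fromℕ (2 + m))) (c zero)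

IsTree : Graph → Set
IsTree G = (1 ≤ n G) × Connected G × ¬ HasCycle G

IsLeaf : (G : Graph) → Fin (n G) → Set
IsLeaf G v = Σ (Fin (n G)) λ w → Adj G v w × (∀ w' → Adj G v w' → w' ≡ w)

IsStar : Graph → Set
IsStar G = IsTree G × Σ (Fin (n G)) λ c → ∀ v → v ≢ c → IsLeaf G v

-- Spikings: vertices inj₁ i are those of T', vertices inj₂ i form the
-- added stable set, with inj₁ i matched to inj₂ i.

spikeAdj⊎ : (T : Graph) → Fin (n T) ⊎ Fin (n T) → Fin (n T) ⊎ Fin (n T) → Bool
spikeAdj⊎ T (inj₁ i) (inj₁ j) = adj T i j
spikeAdj⊎ T (inj₁ i) (inj₂ j) = ⌊ i ≟ j ⌋
spikeAdj⊎ T (inj₂ i) (inj₁ j) = ⌊ i ≟ j ⌋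
spikeAdj⊎ T (inj₂ i) (inj₂ j) = false

spikeAdj : (T : Graph) → Fin (n T + n T) → Fin (n T + n T) → Bool
spikeAdj T u v = spikeAdj⊎ T (splitAt (n T) u) (splitAt (n T) v)

IsSpikingOf : Graph → Graph → Set
IsSpikingOf T T' =
  Σ (Fin (n T' + n T') ↔ Fin (n T)) λ e →
    ∀ u v → adj T (Inverse.to e u) (Inverse.to e v) ≡ spikeAdj T' u v

IsSpiked : Graph → Set
IsSpiked T = Σ Graph λ T' → IsTree T' × IsSpikingOf T T'

IsSpikedStar : Graph → Set
IsSpikedStar T = Σ Graph λ T' → IsStar T' × IsSpikingOf T T'

-- Partitions of V(G) into suc k parts, given as p : Fin (n G) → Fin (suc k);
-- part X_1 is Part p zero.

Interesting : ∀ {k} → Graph → (G : Graph) → (Fin (n G) → Fin (suc k)) → Set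
Interesting T G p =
  (∀ j a b → IsAlpha G (Part p zero) a → IsAlpha G (Part p j) b → b ≤ a) ×
  (∀ i → HasClique G (Part p i) (n T) ⊎ HasStable G (Part p i) (n T))

Witnessing : ∀ {k} → (T : Graph) → (G : Graph) → (Fin (n G) → Fin k) → Set
Witnessing {k} T G p =
  (q : Fin (n T) → Fin k) → Σ (Fin k) λ i → ¬ Embeds T (Part q i) G (Part p i)

Certifying : ∀ {k} → (T : Graph) → (G : Graph) → (Fin (n G) → Fin (suc k)) → Set
Certifying T G p =
  Witnessing T G p ×
  (∀ j a b → IsAlpha G (Part p zero) a → IsAlpha G (Part p j) b → b ≤ a) ×
  ((∀ i → i ≢ zero → HasClique G (Part p i) (n T)) ×
   (HasClique G (Part p zero) (n T) ⊎ HasStable G (Part p zero) (n T))) ×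
  (∀ i → P4Free G (Part p i))

CondI : ∀ {k} → (G : Graph) → (Fin (n G) → Fin (suc k)) → Set
CondI {k} G p =
  CoMatching G (Part p zero) ×
  Σ (Fin (suc k)) λ j → j ≢ zero × CoMatching G (Part p j) ×
    (∀ i → i ≢ zero → i ≢ j → Clique G (Part p i))

CoComponent : (G : Graph) → VSet (n G) → Fin (n G) → VSet (n G)
CoComponent G X u v = X v × Walk X (λ a b → a ≢ b × NonAdj G a b) u v

Stable3 : (G : Graph) → VSet (n G) → Set
Stable3 G C =
  Σ (Fin (n G)) λ a → Σ (Fin (n G)) λ b → Σ (Fin (n G)) λ c →
    (a ≢ b × a ≢ c × b ≢ c) ×
    (C a × C b × C c) × (∀ v → C v → v ≡ a ⊎ v ≡ b ⊎ v ≡ c) ×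
    (NonAdj G a b × NonAdj G a c × NonAdj G b c)

VertexPlusCoMatching : (G : Graph) → VSet (n G) → Set
VertexPlusCoMatching G C =
  Σ (Fin (n G)) λ w → C w × (∀ v → C v → v ≢ w → NonAdj G w v) ×
    CoMatching G (λ v → C v × v ≢ w)

CondII : ∀ {k} → (G : Graph) → (Fin (n G) → Fin (suc k)) → Set
CondII G p =
  (∀ i → i ≢ zero → Clique G (Part p i)) ×
  (∀ u → Part p zero u →
     Stable3 G (CoComponent G (Part p zero) u) ⊎
     VertexPlusCoMatching G (CoComponent G (Part p zero) u))

-- Write T as the spiking of a tree T′ on t = α(T) vertices; a partition then has t − 1 parts
-- and T has 2t vertices, t of them spikes.
--
-- If a partition of V(T) into t − 1 parts embedded part by part into G, each part
-- would be a clique of the forest T (at most two vertices), a comatching of T (at most three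
-- vertices) or, under (ii), a {4K₁, K₂+2K₁, 2K₂, P₄}-free set.  Pigeonhole on the t spikes and
-- counting the 2t vertices show that no such partition exists.
--
-- As T′ is not a star it contains an induced P₄, whose spiking has eight vertices.
-- If X₁ contained 4K₁, K₂+2K₁ or 2K₂, or if two parts contained three-vertex graphs with a
-- non-edge which are not both P₃, or two P₃'s and a third part a non-edge, an explicit
-- splitting of the spiked P₄ into three pieces, with one base–spike edge in every remaining
-- part (which is a large clique), would embed T into G.  Excluding these configurations gives
-- (i) or (ii); in (ii) X₁ is {4K₁, K₂+2K₁, 2K₂, P₄}-free, and every co-component of such a graph
-- is an isolated vertex together with the complement of a matching.

{-# OPTIONS --safe #-}
module Submission where

open import Defs
open import Data.Bool using (Bool; true; false; not; _∧_; _∨_; if_then_else_)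
open import Data.Bool.Properties using (∨-comm; ∨-identityʳ) renaming (_≟_ to _≟ᵇ_)
open import Data.Empty using (⊥; ⊥-elim)
open import Data.Fin using (Fin; zero; suc; _≟_; inject≤; _↑ˡ_; _↑ʳ_; splitAt; join; fromℕ<; cast)
open import Data.Fin.Patterns using (0F; 1F; 2F; 3F)
open import Data.Fin.Permutation using (Permutation′; _⟨$⟩ʳ_; _⟨$⟩ˡ_; _∘ₚ_; transpose; inverseˡ; cast-id)
import Data.Fin.Permutation as Perm
open import Data.Fin.Properties using (any?; all?; inject≤-injective; injective⇒≤; splitAt-↑ˡ; splitAt-↑ʳ; splitAt⁻¹-↑ˡ; splitAt⁻¹-↑ʳ; ↑ˡ-injective; ↑ʳ-injective; suc-injective; pigeonhole; <⇒≢; +↔⊎; cast-involutive)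
open import Data.Nat as ℕ using (ℕ; _+_; _*_; _≤_; _<_; z≤n; s≤s; _≤?_)
open import Data.Nat.Properties using (+-0-commutativeMonoid; +-mono-≤; ≰⇒>; *-identityʳ; *-zeroʳ; ≤-refl; ≤-trans; ≤-reflexive; <-irrefl; n<1+n; ≤-antisym; ≤-pred; ≤∧≢⇒<; m≤m+n)
open import Data.Nat.Solver using (module +-*-Solver)
open import Algebra.Properties.CommutativeMonoid.Sum +-0-commutativeMonoid using (sum; sum-syntax; ∑-comm; ∑-distrib-+; sum-cong-≗)
open import Data.Product using (Σ; _×_; _,_; proj₁; proj₂)
open import Data.Sum using (_⊎_; inj₁; inj₂; [_,_])
import Data.Sum
open import Data.Unit using (tt)
open import Data.Vec.Functional using (_∷_; []; head; tail)
open import Function using (_∘_; id; _↔_; Inverse)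
open import Function.Bundles using (_⇔_; mk⇔; Injection)
open import Function.Construct.Composition using (_↔-∘_)
open import Function.Construct.Symmetry using (↔-sym)
open import Function.Properties.Inverse using (↔⇒↣)
open import Relation.Nullary using (¬_; Dec; yes; no; does)
open import Relation.Nullary.Decidable using (⌊_⌋; _×-dec_; _→-dec_; ¬?; decidable-stable; True; toWitness; dec-true; dec-false)
open import Relation.Unary using (Decidable)
open import Relation.Binary.PropositionalEquality using (_≡_; _≢_; refl; sym; trans; cong; cong₂; subst)

true≢false : ∀ {b} → b ≡ true → b ≡ false → ⊥
true≢false refl ()

⌊≟⌋-sym : ∀ {k} (u v : Fin k) → ⌊ u ≟ v ⌋ ≡ ⌊ v ≟ u ⌋
⌊≟⌋-sym u v with u ≟ v | v ≟ u
... | yes _ | yes _ = refl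
... | no _ | no _ = refl
... | yes u≡v | no v≢u = ⊥-elim (v≢u (sym u≡v))
... | no u≢v | yes v≡u = ⊥-elim (u≢v (sym v≡u))

⌊≟⌋-refl : ∀ {k} (u : Fin k) → ⌊ u ≟ u ⌋ ≡ true
⌊≟⌋-refl u with u ≟ u
... | yes _ = refl
... | no u≢u = ⊥-elim (u≢u refl)

⌊≟⌋-≢ : ∀ {k} {u v : Fin k} → u ≢ v → ⌊ u ≟ v ⌋ ≡ false
⌊≟⌋-≢ {u = u} {v} u≢v with u ≟ v
... | yes u≡v = ⊥-elim (u≢v u≡v)
... | no _ = refl

⌊≟⌋⇒≡ : ∀ {k} {u v : Fin k} → ⌊ u ≟ v ⌋ ≡ true → u ≡ v
⌊≟⌋⇒≡ {u = u} {v} e with u ≟ v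
... | yes u≡v = u≡v

module _ (G : Graph) where

  Adj-sym : ∀ {u v} → Adj G u v → Adj G v u
  Adj-sym {u} {v} e = trans (adj-sym G v u) e

  NonAdj-sym : ∀ {u v} → NonAdj G u v → NonAdj G v u
  NonAdj-sym {u} {v} e = trans (adj-sym G v u) e

  Adj⇒≢ : ∀ {u v} → Adj G u v → u ≢ v
  Adj⇒≢ {u} e refl = true≢false e (adj-irrefl G u)

  Adj⊎NonAdj : ∀ u v → Adj G u v ⊎ NonAdj G u v
  Adj⊎NonAdj u v with adj G u v
  ... | true = inj₁ refl
  ... | false = inj₂ refl

Part? : ∀ {m k} (p : Fin m → Fin k) i v → Dec (Part p i v)
Part? p i v = p v ≟ i

symmetrise : ∀ {k} → (Fin k → Fin k → Bool) → Graph
symmetrise {k} E = record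
  { n = k
  ; adj = λ u v → not ⌊ u ≟ v ⌋ ∧ (E u v ∨ E v u)
  ; adj-sym = λ u v → cong₂ (λ a b → not a ∧ b) (⌊≟⌋-sym u v) (∨-comm (E u v) (E v u))
  ; adj-irrefl = λ u → cong (λ a → not a ∧ (E u u ∨ E u u)) (⌊≟⌋-refl u)
  }

complete edgeless : ℕ → Graph
complete k = symmetrise {k} λ _ _ → true
edgeless k = symmetrise {k} λ _ _ → false

graph₃ : (b₀₁ b₀₂ b₁₂ : Bool) → Graph
graph₃ b₀₁ b₀₂ b₁₂ = symmetrise E
  where
  E : Fin 3 → Fin 3 → Bool
  E 0F 1F = b₀₁
  E 0F 2F = b₀₂
  E 1F 2F = b₁₂
  E _ _ = false

graph₄ : (b₀₁ b₀₂ b₀₃ b₁₂ b₁₃ b₂₃ : Bool) → Graph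
graph₄ b₀₁ b₀₂ b₀₃ b₁₂ b₁₃ b₂₃ = symmetrise E
  where
  E : Fin 4 → Fin 4 → Bool
  E 0F 1F = b₀₁
  E 0F 2F = b₀₂
  E 0F 3F = b₀₃
  E 1F 2F = b₁₂
  E 1F 3F = b₁₃
  E 2F 3F = b₂₃
  E _ _ = false

K₂ 2K₁ P₃ K₂+K₁ 3K₁ P₄ K₂+2K₁ 2K₂ 4K₁ : Graph
K₂ = complete 2
2K₁ = edgeless 2
P₃ = graph₃ true false true
K₂+K₁ = graph₃ true false false
3K₁ = graph₃ false false false
P₄ = graph₄ true false false true false true
K₂+2K₁ = graph₄ true false false false false false
2K₂ = graph₄ true false false false false true
4K₁ = graph₄ false false false false false false

Free : Graph → (G : Graph) → VSet (n G) → Set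
Free H G X = ¬ Embeds H full G X

Embeds-trans : ∀ {A B C X Y Z} → Embeds A X B Y → Embeds B Y C Z → Embeds A X C Z
Embeds-trans (f , fXY , f-inj , f-adj) (g , gYZ , g-inj , g-adj) =
  g ∘ f ,
  (λ v Xv → gYZ (f v) (fXY v Xv)) ,
  (λ u v Xu Xv e → f-inj u v Xu Xv (g-inj (f u) (f v) (fXY u Xu) (fXY v Xv) e)) ,
  (λ u v Xu Xv → trans (g-adj (f u) (f v) (fXY u Xu) (fXY v Xv)) (f-adj u v Xu Xv))

Embeds-restrict : ∀ {A B} {X X' : VSet (n A)} {Y Y' : VSet (n B)} → ((f , _) : Embeds A X B Y) →
                  (∀ v → X' v → X v × Y' (f v)) → Embeds A X' B Y'
Embeds-restrict (f , _ , f-inj , f-adj) X'⇒ =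
  f , (λ v X'v → proj₂ (X'⇒ v X'v)) ,
  (λ u v X'u X'v → f-inj u v (proj₁ (X'⇒ u X'u)) (proj₁ (X'⇒ v X'v))) ,
  (λ u v X'u X'v → f-adj u v (proj₁ (X'⇒ u X'u)) (proj₁ (X'⇒ v X'v)))

module _ (G : Graph) (X : VSet (n G)) where

  Clique-reflect : ∀ {A Y} → Embeds A Y G X → Clique G X → Clique A Y
  Clique-reflect (f , fX , f-inj , f-adj) cl u v Yu Yv u≢v =
    trans (sym (f-adj u v Yu Yv)) (cl (f u) (f v) (fX u Yu) (fX v Yv) (u≢v ∘ f-inj u v Yu Yv))

  CoMatching-reflect : ∀ {A Y} → Embeds A Y G X → CoMatching G X → CoMatching A Y
  CoMatching-reflect (f , fX , f-inj , f-adj) cm u v w Yu Yv Yw u≢v u≢w uv uw =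
    f-inj v w Yv Yw (cm (f u) (f v) (f w) (fX u Yu) (fX v Yv) (fX w Yw)
                        (u≢v ∘ f-inj u v Yu Yv) (u≢w ∘ f-inj u w Yu Yw)
                        (trans (f-adj u v Yu Yv) uv) (trans (f-adj u w Yu Yw) uw))

  clique⇒embeds : ∀ {k} → HasClique G X k → Embeds (complete k) full G X
  clique⇒embeds (f , f-inj , fX , f-adj) = f , (λ v _ → fX v) , (λ u v _ _ → f-inj u v) , adjacent
    where
    adjacent : ∀ u v → full u → full v → adj G (f u) (f v) ≡ adj (complete _) u v
    adjacent u v _ _ with u ≟ v
    ... | yes refl = adj-irrefl G (f u)
    ... | no u≢v = f-adj u v u≢v

  stable⇒embeds : ∀ {k} → HasStable G X k → Embeds (edgeless k) full G X
  stable⇒embeds (f , f-inj , fX , f-adj) = f , (λ v _ → fX v) , (λ u v _ _ → f-inj u v) , adjacent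
    where
    adjacent : ∀ u v → full u → full v → adj G (f u) (f v) ≡ adj (edgeless _) u v
    adjacent u v _ _ with u ≟ v
    ... | yes refl = adj-irrefl G (f u)
    ... | no u≢v = f-adj u v

  HasClique-≤ : ∀ {k s} → k ≤ s → HasClique G X s → HasClique G X k
  HasClique-≤ k≤s (f , f-inj , fX , f-adj) =
    f ∘ inject≤′ , (λ i j e → inject≤-injective k≤s k≤s i j (f-inj _ _ e)) , (λ i → fX _) ,
    (λ i j i≢j → f-adj _ _ (i≢j ∘ inject≤-injective k≤s k≤s i j))
    where inject≤′ = λ i → inject≤ i k≤s

  HasStable-≤ : ∀ {k s} → k ≤ s → HasStable G X s → HasStable G X k
  HasStable-≤ k≤s (f , f-inj , fX , f-adj) =
    f ∘ inject≤′ , (λ i j e → inject≤-injective k≤s k≤s i j (f-inj _ _ e)) , (λ i → fX _) , (λ i j → f-adj _ _)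
    where inject≤′ = λ i → inject≤ i k≤s

  embed₃ : ∀ {b₀₁ b₀₂ b₁₂ x y z} → X x → X y → X z → x ≢ y → x ≢ z → y ≢ z →
           adj G x y ≡ b₀₁ → adj G x z ≡ b₀₂ → adj G y z ≡ b₁₂ → Embeds (graph₃ b₀₁ b₀₂ b₁₂) full G X
  embed₃ {b₀₁} {b₀₂} {b₁₂} {x} {y} {z} Xx Xy Xz x≢y x≢z y≢z xy xz yz =
    f , (λ { 0F _ → Xx ; 1F _ → Xy ; 2F _ → Xz }) , (λ u v _ _ → injective u v) , (λ u v _ _ → adjacent u v)
    where
    H : Graph
    H = graph₃ b₀₁ b₀₂ b₁₂
    f : Fin 3 → Fin (n G)
    f 0F = x
    f 1F = y
    f 2F = z
    injective : ∀ u v → f u ≡ f v → u ≡ v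
    injective 0F 0F _ = refl
    injective 0F 1F e = ⊥-elim (x≢y e)
    injective 0F 2F e = ⊥-elim (x≢z e)
    injective 1F 0F e = ⊥-elim (x≢y (sym e))
    injective 1F 1F _ = refl
    injective 1F 2F e = ⊥-elim (y≢z e)
    injective 2F 0F e = ⊥-elim (x≢z (sym e))
    injective 2F 1F e = ⊥-elim (y≢z (sym e))
    injective 2F 2F _ = refl
    -- adjacency of i < j in H computes to b_ij ∨ false
    upper : ∀ {u v b} → adj G (f u) (f v) ≡ b → adj G (f u) (f v) ≡ b ∨ false
    upper {b = b} e = trans e (sym (∨-identityʳ b))
    lower : ∀ {u v} → adj G (f v) (f u) ≡ adj H v u → adj G (f u) (f v) ≡ adj H u v
    lower {u} {v} e = trans (adj-sym G (f u) (f v)) (trans e (adj-sym H v u))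
    diagonal : ∀ u → adj G (f u) (f u) ≡ adj H u u
    diagonal u = trans (adj-irrefl G (f u)) (sym (adj-irrefl H u))
    adjacent : ∀ u v → adj G (f u) (f v) ≡ adj H u v
    adjacent 0F 1F = upper xy
    adjacent 0F 2F = upper xz
    adjacent 1F 2F = upper yz
    adjacent 1F 0F = lower (upper xy)
    adjacent 2F 0F = lower (upper xz)
    adjacent 2F 1F = lower (upper yz)
    adjacent 0F 0F = diagonal 0F
    adjacent 1F 1F = diagonal 1F
    adjacent 2F 2F = diagonal 2F

  embed₄ : ∀ {b₀₁ b₀₂ b₀₃ b₁₂ b₁₃ b₂₃ x y z w} → X x → X y → X z → X w →
           x ≢ y → x ≢ z → x ≢ w → y ≢ z → y ≢ w → z ≢ w →
           adj G x y ≡ b₀₁ → adj G x z ≡ b₀₂ → adj G x w ≡ b₀₃ →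
           adj G y z ≡ b₁₂ → adj G y w ≡ b₁₃ → adj G z w ≡ b₂₃ →
           Embeds (graph₄ b₀₁ b₀₂ b₀₃ b₁₂ b₁₃ b₂₃) full G X
  embed₄ {b₀₁} {b₀₂} {b₀₃} {b₁₂} {b₁₃} {b₂₃} {x} {y} {z} {w} Xx Xy Xz Xw
         x≢y x≢z x≢w y≢z y≢w z≢w xy xz xw yz yw zw =
    f , (λ { 0F _ → Xx ; 1F _ → Xy ; 2F _ → Xz ; 3F _ → Xw }) ,
    (λ u v _ _ → injective u v) , (λ u v _ _ → adjacent u v)
    where
    H : Graph
    H = graph₄ b₀₁ b₀₂ b₀₃ b₁₂ b₁₃ b₂₃
    f : Fin 4 → Fin (n G)
    f 0F = x
    f 1F = y
    f 2F = z
    f 3F = w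
    injective : ∀ u v → f u ≡ f v → u ≡ v
    injective 0F 0F _ = refl
    injective 0F 1F e = ⊥-elim (x≢y e)
    injective 0F 2F e = ⊥-elim (x≢z e)
    injective 0F 3F e = ⊥-elim (x≢w e)
    injective 1F 0F e = ⊥-elim (x≢y (sym e))
    injective 1F 1F _ = refl
    injective 1F 2F e = ⊥-elim (y≢z e)
    injective 1F 3F e = ⊥-elim (y≢w e)
    injective 2F 0F e = ⊥-elim (x≢z (sym e))
    injective 2F 1F e = ⊥-elim (y≢z (sym e))
    injective 2F 2F _ = refl
    injective 2F 3F e = ⊥-elim (z≢w e)
    injective 3F 0F e = ⊥-elim (x≢w (sym e))
    injective 3F 1F e = ⊥-elim (y≢w (sym e))
    injective 3F 2F e = ⊥-elim (z≢w (sym e))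
    injective 3F 3F _ = refl
    upper : ∀ {u v b} → adj G (f u) (f v) ≡ b → adj G (f u) (f v) ≡ b ∨ false
    upper {b = b} e = trans e (sym (∨-identityʳ b))
    lower : ∀ {u v} → adj G (f v) (f u) ≡ adj H v u → adj G (f u) (f v) ≡ adj H u v
    lower {u} {v} e = trans (adj-sym G (f u) (f v)) (trans e (adj-sym H v u))
    diagonal : ∀ u → adj G (f u) (f u) ≡ adj H u u
    diagonal u = trans (adj-irrefl G (f u)) (sym (adj-irrefl H u))
    adjacent : ∀ u v → adj G (f u) (f v) ≡ adj H u v
    adjacent 0F 1F = upper xy
    adjacent 0F 2F = upper xz
    adjacent 0F 3F = upper xw
    adjacent 1F 2F = upper yz
    adjacent 1F 3F = upper yw
    adjacent 2F 3F = upper zw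
    adjacent 1F 0F = lower (upper xy)
    adjacent 2F 0F = lower (upper xz)
    adjacent 3F 0F = lower (upper xw)
    adjacent 2F 1F = lower (upper yz)
    adjacent 3F 1F = lower (upper yw)
    adjacent 3F 2F = lower (upper zw)
    adjacent 0F 0F = diagonal 0F
    adjacent 1F 1F = diagonal 1F
    adjacent 2F 2F = diagonal 2F
    adjacent 3F 3F = diagonal 3F

module _ (G : Graph) {X : VSet (n G)} (X? : ∀ v → Dec (X v)) where

  Clique? : Dec (Clique G X)
  Clique? = all? λ u → all? λ v → X? u →-dec X? v →-dec ¬? (u ≟ v) →-dec (adj G u v ≟ᵇ true)

  CoMatching? : Dec (CoMatching G X)
  CoMatching? = all? λ u → all? λ v → all? λ w → X? u →-dec X? v →-dec X? w →-dec ¬? (u ≟ v) →-dec ¬? (u ≟ w) →-dec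
                  (adj G u v ≟ᵇ false) →-dec (adj G u w ≟ᵇ false) →-dec (v ≟ w)

module _ (G : Graph) {X : VSet (n G)} where

  Clique⇒¬HasStable : ∀ {s} → Clique G X → 2 ≤ s → ¬ HasStable G X s
  Clique⇒¬HasStable clique 2≤s stable with HasStable-≤ G X 2≤s stable
  ... | f , f-inj , fX , f-stable = true≢false (clique (f 0F) (f 1F) (fX 0F) (fX 1F) ((λ ()) ∘ f-inj 0F 1F)) (f-stable 0F 1F)

  CoMatching⇒¬HasStable : ∀ {s} → CoMatching G X → 3 ≤ s → ¬ HasStable G X s
  CoMatching⇒¬HasStable comatching 3≤s stable with HasStable-≤ G X 3≤s stable
  ... | f , f-inj , fX , f-stable =
    1≢2 (f-inj 1F 2F (comatching (f 0F) (f 1F) (f 2F) (fX 0F) (fX 1F) (fX 2F) ((λ ()) ∘ f-inj 0F 1F) ((λ ()) ∘ f-inj 0F 2F)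
                                     (f-stable 0F 1F) (f-stable 0F 2F)))
    where
    1≢2 : 1F ≢ 2F
    1≢2 ()

non-edge⇒HasStable₂ : ∀ G {X : VSet (n G)} {u v} → X u → X v → u ≢ v → NonAdj G u v → HasStable G X 2
non-edge⇒HasStable₂ G {u = u} {v} Xu Xv u≢v uv = f , injective , (λ { 0F → Xu ; 1F → Xv }) , stable
  where
  f : Fin 2 → Fin (n G)
  f 0F = u
  f 1F = v
  injective : ∀ i j → f i ≡ f j → i ≡ j
  injective 0F 0F _ = refl
  injective 0F 1F eq = ⊥-elim (u≢v eq)
  injective 1F 0F eq = ⊥-elim (u≢v (sym eq))
  injective 1F 1F _ = refl
  stable : ∀ i j → NonAdj G (f i) (f j)
  stable 0F 0F = adj-irrefl G u
  stable 0F 1F = uv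
  stable 1F 0F = NonAdj-sym G uv
  stable 1F 1F = adj-irrefl G v

stable⇒4K₁ : ∀ G {X : VSet (n G)} → HasStable G X 4 → Embeds 4K₁ full G X
stable⇒4K₁ G {X} (f , f-inj , fX , f-stable) =
  embed₄ G X (fX 0F) (fX 1F) (fX 2F) (fX 3F) (d 0F 1F (λ ())) (d 0F 2F (λ ())) (d 0F 3F (λ ())) (d 1F 2F (λ ()))
         (d 1F 3F (λ ())) (d 2F 3F (λ ())) (f-stable 0F 1F) (f-stable 0F 2F) (f-stable 0F 3F) (f-stable 1F 2F)
         (f-stable 1F 3F) (f-stable 2F 3F)
  where
  d : ∀ i j → i ≢ j → f i ≢ f j
  d i j i≢j = i≢j ∘ f-inj i j

∃-function? : ∀ s {N} (P : (Fin s → Fin N) → Set) → (∀ f → Dec (P f)) → (∀ {f g} → (∀ i → f i ≡ g i) → P f → P g) →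
              Dec (Σ (Fin s → Fin N) P)
∃-function? ℕ.zero P P? P-ext with P? (λ ())
... | yes P-empty = yes ((λ ()) , P-empty)
... | no ¬P-empty = no λ (f , Pf) → ¬P-empty (P-ext (λ ()) Pf)
∃-function? (ℕ.suc s) P P? P-ext
  with any? (λ x → ∃-function? s (P ∘ (x ∷_)) (P? ∘ (x ∷_)) λ f≗g → P-ext λ { zero → refl ; (suc i) → f≗g i })
... | yes (x , f , Pf) = yes (x ∷ f , Pf)
... | no none = no λ (f , Pf) → none (head f , tail f , P-ext (λ { zero → refl ; (suc i) → refl }) Pf)

module _ (G : Graph) {X : VSet (n G)} (X? : ∀ v → Dec (X v)) where

  HasStable? : ∀ s → Dec (HasStable G X s)
  HasStable? s = ∃-function? s _
    (λ f → all? (λ i → all? λ j → (f i ≟ f j) →-dec (i ≟ j)) ×-dec all? (X? ∘ f) ×-dec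
           all? (λ i → all? λ j → adj G (f i) (f j) ≟ᵇ false))
    λ f≗g (f-inj , fX , f-stable) →
      (λ i j gi≡gj → f-inj i j (trans (f≗g i) (trans gi≡gj (sym (f≗g j))))) ,
      (λ i → subst X (f≗g i) (fX i)) ,
      (λ i j → trans (cong₂ (adj G) (sym (f≗g i)) (sym (f≗g j))) (f-stable i j))

  largest-stable-≤ : ∀ k → Σ ℕ λ a → HasStable G X a × (∀ s → s ≤ k → HasStable G X s → s ≤ a)
  largest-stable-≤ ℕ.zero = 0 , ((λ ()) , (λ ()) , (λ ()) , (λ ())) , λ { s z≤n _ → z≤n }
  largest-stable-≤ (ℕ.suc k) with HasStable? (ℕ.suc k) | largest-stable-≤ k
  ... | yes stable | _ = ℕ.suc k , stable , λ s s≤1+k _ → s≤1+k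
  ... | no ¬stable | a , stable , maximal = a , stable , λ s s≤1+k s-stable →
    maximal s (≤-pred (≤∧≢⇒< s≤1+k λ { refl → ¬stable s-stable })) s-stable

  α-exists : Σ ℕ (IsAlpha G X)
  α-exists with largest-stable-≤ (n G)
  ... | a , stable , maximal = a , stable , λ s s-stable@(f , f-inj , _) → maximal s (injective⇒≤ (f-inj _ _)) s-stable

to-injective : ∀ {k l} (e : Fin k ↔ Fin l) {u v} → Inverse.to e u ≡ Inverse.to e v → u ≡ v
to-injective e = Injection.injective (↔⇒↣ e)

record _≅_ (A B : Graph) : Set where
  constructor mk≅
  field
    bijection : Fin (n A) ↔ Fin (n B)
    adj-preserved : ∀ u v → adj B (Inverse.to bijection u) (Inverse.to bijection v) ≡ adj A u v

  open Inverse bijection public using (to; from)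

≅-sym : ∀ {A B} → A ≅ B → B ≅ A
≅-sym {B = B} (mk≅ e law) = mk≅ (↔-sym e) λ u v →
  trans (sym (law (from u) (from v))) (cong₂ (adj B) (strictlyInverseˡ u) (strictlyInverseˡ v))
  where open Inverse e

≅⇒Embeds : ∀ {A B} (e : A ≅ B) (Y : VSet (n B)) → Embeds A (Y ∘ _≅_.to e) B Y
≅⇒Embeds (mk≅ e law) Y = Inverse.to e , (λ _ Yv → Yv) , (λ u v _ _ → to-injective e) , (λ u v _ _ → law u v)

≅⇒≤ : ∀ {A B} → A ≅ B → n A ≤ n B
≅⇒≤ (mk≅ e _) = injective⇒≤ (to-injective e)

HasStable-≅ : ∀ {A B s} → A ≅ B → HasStable A full s → HasStable B full s
HasStable-≅ (mk≅ e law) (f , f-inj , _ , f-stable) =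
  Inverse.to e ∘ f , (λ i j eq → f-inj i j (to-injective e eq)) , (λ _ → tt) ,
  (λ i j → trans (law (f i) (f j)) (f-stable i j))

Witnessing-≅ : ∀ {A B G k} {p : Fin (n G) → Fin k} → A ≅ B → Witnessing A G p → Witnessing B G p
Witnessing-≅ {A} {B} {G} {p = p} e W q with W (q ∘ _≅_.to e)
... | i , ¬embeds = i , λ embeds →
  ¬embeds (Embeds-trans {A} {B} {G} {Y = Part q i} {Z = Part p i} (≅⇒Embeds e (Part q i)) embeds)

-- Spikings

spikeAdj⊎-sym : (T : Graph) → ∀ u v → spikeAdj⊎ T u v ≡ spikeAdj⊎ T v u
spikeAdj⊎-sym T (inj₁ x) (inj₁ y) = adj-sym T x y
spikeAdj⊎-sym _ (inj₁ x) (inj₂ y) = ⌊≟⌋-sym x y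
spikeAdj⊎-sym _ (inj₂ x) (inj₁ y) = ⌊≟⌋-sym x y
spikeAdj⊎-sym _ (inj₂ _) (inj₂ _) = refl

spiking : Graph → Graph
spiking T = record
  { n = n T + n T
  ; adj = spikeAdj T
  ; adj-sym = λ u v → spikeAdj⊎-sym T (splitAt (n T) u) (splitAt (n T) v)
  ; adj-irrefl = irrefl ∘ splitAt (n T)
  }
  where
  irrefl : ∀ s → spikeAdj⊎ T s s ≡ false
  irrefl (inj₁ x) = adj-irrefl T x
  irrefl (inj₂ _) = refl

spikedP₄ : Graph
spikedP₄ = spiking P₄

TriangleFree : Graph → Set
TriangleFree G = ∀ a b c → Adj G a b → Adj G b c → Adj G a c → ⊥

SquareFree : Graph → Set
SquareFree G = ∀ a b c d → Adj G a b → Adj G b c → Adj G c d → Adj G d a → a ≢ c → b ≢ d → ⊥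

module Spiking (T : Graph) where

  base spike : Fin (n T) → Fin (n T + n T)
  base x = x ↑ˡ n T
  spike x = n T ↑ʳ x

  data SpikingView : Fin (n T + n T) → Set where
    at-base : ∀ x → SpikingView (base x)
    at-spike : ∀ x → SpikingView (spike x)

  view : ∀ w → SpikingView w
  view w with splitAt (n T) w in eq
  ... | inj₁ x = subst SpikingView (splitAt⁻¹-↑ˡ eq) (at-base x)
  ... | inj₂ x = subst SpikingView (splitAt⁻¹-↑ʳ eq) (at-spike x)

  index : Fin (n T + n T) → Fin (n T)
  index = [ id , id ] ∘ splitAt (n T)

  index-base : ∀ x → index (base x) ≡ x
  index-base x rewrite splitAt-↑ˡ (n T) x (n T) = refl

  index-spike : ∀ x → index (spike x) ≡ x
  index-spike x rewrite splitAt-↑ʳ (n T) (n T) x = refl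

  adj-base-base : ∀ x y → adj (spiking T) (base x) (base y) ≡ adj T x y
  adj-base-base x y rewrite splitAt-↑ˡ (n T) x (n T) | splitAt-↑ˡ (n T) y (n T) = refl

  adj-base-spike : ∀ x y → adj (spiking T) (base x) (spike y) ≡ ⌊ x ≟ y ⌋
  adj-base-spike x y rewrite splitAt-↑ˡ (n T) x (n T) | splitAt-↑ʳ (n T) (n T) y = refl

  adj-spike-base : ∀ x y → adj (spiking T) (spike x) (base y) ≡ ⌊ x ≟ y ⌋
  adj-spike-base x y rewrite splitAt-↑ʳ (n T) (n T) x | splitAt-↑ˡ (n T) y (n T) = refl

  adj-spike-spike : ∀ x y → adj (spiking T) (spike x) (spike y) ≡ false
  adj-spike-spike x y rewrite splitAt-↑ʳ (n T) (n T) x | splitAt-↑ʳ (n T) (n T) y = refl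

  base-injective : ∀ {x y} → base x ≡ base y → x ≡ y
  base-injective = ↑ˡ-injective (n T) _ _

  spike-injective : ∀ {x y} → spike x ≡ spike y → x ≡ y
  spike-injective = ↑ʳ-injective (n T) _ _

  base≢spike : ∀ x y → base x ≢ spike y
  base≢spike x y eq with trans (sym (splitAt-↑ˡ (n T) x (n T))) (trans (cong (splitAt (n T)) eq) (splitAt-↑ʳ (n T) (n T) y))
  ... | ()

  base-spike-adjacent : ∀ x → Adj (spiking T) (base x) (spike x)
  base-spike-adjacent x = trans (adj-base-spike x x) (⌊≟⌋-refl x)

  spike-base-adjacent : ∀ x → Adj (spiking T) (spike x) (base x)
  spike-base-adjacent x = trans (adj-spike-base x x) (⌊≟⌋-refl x)

  base-spike-nonadjacent : ∀ {x y} → x ≢ y → NonAdj (spiking T) (base x) (spike y)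
  base-spike-nonadjacent {x} {y} x≢y = trans (adj-base-spike x y) (⌊≟⌋-≢ x≢y)

  spike-base-nonadjacent : ∀ {x y} → x ≢ y → NonAdj (spiking T) (spike x) (base y)
  spike-base-nonadjacent {x} {y} x≢y = trans (adj-spike-base x y) (⌊≟⌋-≢ x≢y)

  spike-neighbour : ∀ x w → Adj (spiking T) (spike x) w → w ≡ base x
  spike-neighbour x w a with view w
  ... | at-base y = cong base (sym (⌊≟⌋⇒≡ (trans (sym (adj-spike-base x y)) a)))
  ... | at-spike y = ⊥-elim (true≢false a (adj-spike-spike x y))

  private
    S : Graph
    S = spiking T

  index-nonadjacent : ∀ {u v} → NonAdj S u v → index u ≡ index v → u ≡ v
  index-nonadjacent {u} {v} uv eq with view u | view v
  ... | at-base x | at-base y = cong base (trans (sym (index-base x)) (trans eq (index-base y)))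
  ... | at-spike x | at-spike y = cong spike (trans (sym (index-spike x)) (trans eq (index-spike y)))
  ... | at-base x | at-spike y
    rewrite index-base x | index-spike y | eq = ⊥-elim (true≢false (base-spike-adjacent y) uv)
  ... | at-spike x | at-base y
    rewrite index-spike x | index-base y | eq = ⊥-elim (true≢false (spike-base-adjacent y) uv)

  spikes-stable : HasStable S full (n T)
  spikes-stable = spike , (λ _ _ → spike-injective) , (λ _ → tt) , adj-spike-spike

  stable-bound : ∀ {s} → HasStable S full s → s ≤ n T
  stable-bound (f , f-inj , _ , f-stable) =
    injective⇒≤ {f = index ∘ f} λ {i} {j} eq → f-inj i j (index-nonadjacent (f-stable i j) eq)

  side : Fin (n T + n T) → Fin 2
  side = [ (λ _ → 0F) , (λ _ → 1F) ] ∘ splitAt (n T)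

  pair-embeds : ∀ x → Embeds S (λ w → index w ≡ x) K₂ full
  pair-embeds x = side , (λ _ _ → tt) , injective , adjacency
    where
    side-base : ∀ y → side (base y) ≡ 0F
    side-base y rewrite splitAt-↑ˡ (n T) y (n T) = refl
    side-spike : ∀ y → side (spike y) ≡ 1F
    side-spike y rewrite splitAt-↑ʳ (n T) (n T) y = refl
    injective : ∀ u v → index u ≡ x → index v ≡ x → side u ≡ side v → u ≡ v
    injective u v iu iv eq with view u | view v
    ... | at-base y | at-base z = cong base (trans (sym (index-base y)) (trans (trans iu (sym iv)) (index-base z)))
    ... | at-spike y | at-spike z = cong spike (trans (sym (index-spike y)) (trans (trans iu (sym iv)) (index-spike z)))
    ... | at-base y | at-spike z = ⊥-elim (0≢1 (trans (sym (side-base y)) (trans eq (side-spike z))))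
      where 0≢1 : 0F ≢ 1F
            0≢1 ()
    ... | at-spike y | at-base z = ⊥-elim (0≢1 (trans (sym (side-base z)) (trans (sym eq) (side-spike y))))
      where 0≢1 : 0F ≢ 1F
            0≢1 ()
    adjacency : ∀ u v → index u ≡ x → index v ≡ x → adj K₂ (side u) (side v) ≡ adj S u v
    adjacency u v iu iv with view u | view v
    ... | at-base y | at-base z rewrite side-base y | side-base z | index-base y | index-base z | iu | iv =
      sym (adj-irrefl S (base x))
    ... | at-spike y | at-spike z rewrite side-spike y | side-spike z = sym (adj-spike-spike y z)
    ... | at-base y | at-spike z rewrite side-base y | side-spike z | index-base y | index-spike z | iu | iv =
      sym (base-spike-adjacent x)
    ... | at-spike y | at-base z rewrite side-spike y | side-base z | index-spike y | index-base z | iu | iv =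
      sym (spike-base-adjacent x)

  two-neighbours⇒base : ∀ w u v → Adj S w u → Adj S w v → u ≢ v → Σ (Fin (n T)) λ x → w ≡ base x
  two-neighbours⇒base w u v wu wv u≢v with view w
  ... | at-base x = x , refl
  ... | at-spike x = ⊥-elim (u≢v (trans (spike-neighbour x u wu) (sym (spike-neighbour x v wv))))

  private
    base-adj : ∀ {x y} → Adj S (base x) (base y) → Adj T x y
    base-adj {x} {y} a = trans (sym (adj-base-base x y)) a

  spiking-TriangleFree : TriangleFree T → TriangleFree S
  spiking-TriangleFree triangle-free a b c ab bc ac
    with two-neighbours⇒base a b c ab ac (Adj⇒≢ S bc)
       | two-neighbours⇒base b a c (Adj-sym S ab) bc (Adj⇒≢ S ac)
       | two-neighbours⇒base c a b (Adj-sym S ac) (Adj-sym S bc) (Adj⇒≢ S ab)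
  ... | x , refl | y , refl | z , refl = triangle-free x y z (base-adj ab) (base-adj bc) (base-adj ac)

  spiking-SquareFree : SquareFree T → SquareFree S
  spiking-SquareFree square-free a b c d ab bc cd da a≢c b≢d
    with two-neighbours⇒base a b d ab (Adj-sym S da) b≢d
       | two-neighbours⇒base b a c (Adj-sym S ab) bc a≢c
       | two-neighbours⇒base c b d (Adj-sym S bc) cd b≢d
       | two-neighbours⇒base d c a (Adj-sym S cd) da (a≢c ∘ sym)
  ... | x , refl | y , refl | z , refl | w , refl =
    square-free x y z w (base-adj ab) (base-adj bc) (base-adj cd) (base-adj da) (a≢c ∘ cong base) (b≢d ∘ cong base)

spiking-≅ : ∀ {T T'} → IsSpikingOf T T' → spiking T' ≅ T
spiking-≅ (e , law) = mk≅ e law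

spikeMap : ∀ {a b} → (Fin a → Fin b) → Fin (a + a) → Fin (b + b)
spikeMap {a} {b} f = join b b ∘ Data.Sum.map f f ∘ splitAt a

module _ {A B : Graph} {X : VSet (n A)} {Y : VSet (n B)} where
  private
    module A = Spiking A
    module B = Spiking B

  spiking-embeds : ((f , _) : Embeds A X B Y) → Embeds (spiking A) (X ∘ A.index) (spiking B) (Y ∘ B.index)
  spiking-embeds (f , fY , f-inj , f-adj) = spikeMap f , mapsTo , injective , adjacency
    where
    map-base : ∀ x → spikeMap f (A.base x) ≡ B.base (f x)
    map-base x rewrite splitAt-↑ˡ (n A) x (n A) = refl
    map-spike : ∀ x → spikeMap f (A.spike x) ≡ B.spike (f x)
    map-spike x rewrite splitAt-↑ʳ (n A) (n A) x = refl
    index-map : ∀ w → B.index (spikeMap f w) ≡ f (A.index w)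
    index-map w with A.view w
    ... | A.at-base x rewrite map-base x | B.index-base (f x) | A.index-base x = refl
    ... | A.at-spike x rewrite map-spike x | B.index-spike (f x) | A.index-spike x = refl
    mapsTo : ∀ w → X (A.index w) → Y (B.index (spikeMap f w))
    mapsTo w Xw = subst Y (sym (index-map w)) (fY _ Xw)
    injective : ∀ u v → X (A.index u) → X (A.index v) → spikeMap f u ≡ spikeMap f v → u ≡ v
    injective u v Xu Xv eq with A.view u | A.view v
    ... | A.at-base x | A.at-base y rewrite A.index-base x | A.index-base y | map-base x | map-base y =
      cong A.base (f-inj x y Xu Xv (B.base-injective eq))
    ... | A.at-spike x | A.at-spike y rewrite A.index-spike x | A.index-spike y | map-spike x | map-spike y =
      cong A.spike (f-inj x y Xu Xv (B.spike-injective eq))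
    ... | A.at-base x | A.at-spike y rewrite map-base x | map-spike y = ⊥-elim (B.base≢spike (f x) (f y) eq)
    ... | A.at-spike x | A.at-base y rewrite map-spike x | map-base y = ⊥-elim (B.base≢spike (f y) (f x) (sym eq))
    same-index : ∀ {x y} → X x → X y → ⌊ f x ≟ f y ⌋ ≡ ⌊ x ≟ y ⌋
    same-index {x} {y} Xx Xy with f x ≟ f y | x ≟ y
    ... | yes _ | yes _ = refl
    ... | no _ | no _ = refl
    ... | yes fx≡fy | no x≢y = ⊥-elim (x≢y (f-inj x y Xx Xy fx≡fy))
    ... | no fx≢fy | yes refl = ⊥-elim (fx≢fy refl)
    adjacency : ∀ u v → X (A.index u) → X (A.index v) → adj (spiking B) (spikeMap f u) (spikeMap f v) ≡ adj (spiking A) u v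
    adjacency u v Xu Xv with A.view u | A.view v
    ... | A.at-base x | A.at-base y rewrite A.index-base x | A.index-base y | map-base x | map-base y
      = trans (B.adj-base-base (f x) (f y)) (trans (f-adj x y Xu Xv) (sym (A.adj-base-base x y)))
    ... | A.at-base x | A.at-spike y rewrite A.index-base x | A.index-spike y | map-base x | map-spike y
      = trans (B.adj-base-spike (f x) (f y)) (trans (same-index Xu Xv) (sym (A.adj-base-spike x y)))
    ... | A.at-spike x | A.at-base y rewrite A.index-spike x | A.index-base y | map-spike x | map-base y
      = trans (B.adj-spike-base (f x) (f y)) (trans (same-index Xu Xv) (sym (A.adj-spike-base x y)))
    ... | A.at-spike x | A.at-spike y rewrite map-spike x | map-spike y
      = trans (B.adj-spike-spike (f x) (f y)) (sym (A.adj-spike-spike x y))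

alpha-spiking : ∀ {T T' a} → spiking T' ≅ T → IsAlpha T full a → a ≡ n T'
alpha-spiking {T' = T'} e (stable , maximal) =
  ≤-antisym (stable-bound (HasStable-≅ (≅-sym e) stable)) (maximal _ (HasStable-≅ e spikes-stable))
  where open Spiking T'

module _ {G : Graph} where

  acyclic⇒TriangleFree : ¬ HasCycle G → TriangleFree G
  acyclic⇒TriangleFree acyclic a b c ab bc ac =
    acyclic (0 , proj₁ triangle , (λ i j → proj₁ (proj₂ (proj₂ triangle)) i j tt tt) ,
             (λ { 0F → ab ; 1F → bc }) , Adj-sym G ac)
    where
    triangle : Embeds (graph₃ true true true) full G full
    triangle = embed₃ G full {x = a} {b} {c} tt tt tt (Adj⇒≢ G ab) (Adj⇒≢ G ac) (Adj⇒≢ G bc) ab ac bc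

  acyclic⇒SquareFree : ¬ HasCycle G → SquareFree G
  acyclic⇒SquareFree acyclic a b c d ab bc cd da a≢c b≢d =
    acyclic (1 , proj₁ square , (λ i j → proj₁ (proj₂ (proj₂ square)) i j tt tt) ,
             (λ { 0F → ab ; 1F → bc ; 2F → cd }) , da)
    where
    square : Embeds (graph₄ true (adj G a c) true true (adj G b d) true) full G full
    square = embed₄ G full {x = a} {b} {c} {d} tt tt tt tt
               (Adj⇒≢ G ab) a≢c (Adj⇒≢ G (Adj-sym G da)) (Adj⇒≢ G bc) b≢d (Adj⇒≢ G cd)
               ab refl (Adj-sym G da) bc refl cd

module _ {T : Graph} (tree : IsTree T) where

  private
    triangle-free : TriangleFree T
    triangle-free = acyclic⇒TriangleFree {T} (proj₂ (proj₂ tree))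
    square-free : SquareFree T
    square-free = acyclic⇒SquareFree {T} (proj₂ (proj₂ tree))

  star-at : (c : Fin (n T)) → (∀ y z → Adj T c y → Adj T y z → z ≡ c) → IsStar T
  star-at c closed = tree , c , λ v v≢c → c , Adj-sym T (near v v≢c) , λ w vw → closed v w (near v v≢c) vw
    where
    walk-near : ∀ {u v} → u ≡ c ⊎ Adj T c u → Walk full (Adj T) u v → v ≡ c ⊎ Adj T c v
    walk-near near-u (here _) = near-u
    walk-near (inj₁ refl) (step _ cw w) = walk-near (inj₂ cw) w
    walk-near (inj₂ cu) (step _ uw w) = walk-near (inj₁ (closed _ _ cu uw)) w
    near : ∀ v → v ≢ c → Adj T c v
    near v v≢c with walk-near (inj₁ refl) (proj₁ (proj₂ tree) c v)
    ... | inj₁ v≡c = ⊥-elim (v≢c v≡c)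
    ... | inj₂ cv = cv

  Path₄ : Fin (n T) → Fin (n T) → Fin (n T) → Fin (n T) → Set
  Path₄ a b c d = Adj T a b × Adj T b c × Adj T c d × a ≢ c × b ≢ d

  nonstar⇒path₄ : ¬ IsStar T → Σ _ λ a → Σ _ λ b → Σ _ λ c → Σ _ λ d → Path₄ a b c d
  -- Without such a path, a vertex with two distinct neighbours, or else any vertex, is the centre of a star.
  nonstar⇒path₄ ¬star with any? (λ a → any? λ b → any? λ c → any? λ d →
    (adj T a b ≟ᵇ true) ×-dec (adj T b c ≟ᵇ true) ×-dec (adj T c d ≟ᵇ true) ×-dec ¬? (a ≟ c) ×-dec ¬? (b ≟ d))
  ... | yes path = path
  ... | no ¬path with any? (λ c → any? λ y → any? λ z → (adj T c y ≟ᵇ true) ×-dec (adj T c z ≟ᵇ true) ×-dec ¬? (y ≟ z))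
  ...   | yes (c , y₁ , y₂ , cy₁ , cy₂ , y₁≢y₂) = ⊥-elim (¬star (star-at c closed))
    where
    closed : ∀ y z → Adj T c y → Adj T y z → z ≡ c
    closed y z cy yz with z ≟ c | y ≟ y₁
    ... | yes z≡c | _ = z≡c
    ... | no z≢c | yes refl = ⊥-elim (¬path (z , y , c , y₂ , Adj-sym T yz , Adj-sym T cy , cy₂ , z≢c , y₁≢y₂))
    ... | no z≢c | no y≢y₁ = ⊥-elim (¬path (z , y , c , y₁ , Adj-sym T yz , Adj-sym T cy , cy₁ , z≢c , y≢y₁))
  ...   | no ¬fork = ⊥-elim (¬star (star-at c₀ closed))
    where
    c₀ : Fin (n T)
    c₀ = fromℕ< (proj₁ tree)
    closed : ∀ y z → Adj T c₀ y → Adj T y z → z ≡ c₀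
    closed y z cy yz with z ≟ c₀
    ... | yes z≡c₀ = z≡c₀
    ... | no z≢c₀ = ⊥-elim (¬fork (y , c₀ , z , Adj-sym T cy , yz , z≢c₀ ∘ sym))

  nonstar⇒P₄ : ¬ IsStar T → Embeds P₄ full T full
  nonstar⇒P₄ ¬star with nonstar⇒path₄ ¬star
  ... | a , b , c , d , ab , bc , cd , a≢c , b≢d =
    embed₄ T full tt tt tt tt (Adj⇒≢ T ab) a≢c a≢d (Adj⇒≢ T bc) b≢d (Adj⇒≢ T cd)
           ab (non-adjacent (triangle-free a b c ab bc))
           (non-adjacent λ ad → square-free a b c d ab bc cd (Adj-sym T ad) a≢c b≢d)
           bc (non-adjacent (triangle-free b c d bc cd)) cd
    where
    non-adjacent : ∀ {u v} → ¬ Adj T u v → NonAdj T u v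
    non-adjacent {u} {v} ¬uv with Adj⊎NonAdj T u v
    ... | inj₁ uv = ⊥-elim (¬uv uv)
    ... | inj₂ uv = uv
    a≢d : a ≢ d
    a≢d refl = triangle-free a b c ab bc (Adj-sym T cd)

-- Co-components

CoAdj : (G : Graph) → Fin (n G) → Fin (n G) → Set
CoAdj G a b = a ≢ b × NonAdj G a b

EachCoComponent : ((G : Graph) → VSet (n G) → Set) → (G : Graph) → VSet (n G) → Set
EachCoComponent P G X = ∀ u → X u → P G (CoComponent G X u)

P4Free-reflect : ∀ {A Y G X} → Embeds A Y G X → P4Free G X → P4Free A Y
P4Free-reflect (f , fX , _ , f-adj) p4-free a b c d Ya Yb Yc Yd ab bc cd ac bd ad =
  p4-free (f a) (f b) (f c) (f d) (fX a Ya) (fX b Yb) (fX c Yc) (fX d Yd)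
    (trans (f-adj a b Ya Yb) ab) (trans (f-adj b c Yb Yc) bc) (trans (f-adj c d Yc Yd) cd)
    (trans (f-adj a c Ya Yc) ac) (trans (f-adj b d Yb Yd) bd) (trans (f-adj a d Ya Yd) ad)

module _ (G : Graph) where

  Clique⇒P4Free : ∀ {X} → Clique G X → P4Free G X
  Clique⇒P4Free clique _ b _ d _ Xb _ Xd ab _ _ _ bd ad = true≢false (clique b d Xb Xd b≢d) bd
    where
    b≢d : b ≢ d
    b≢d refl = true≢false ab ad

  CoMatching⇒P4Free : ∀ {X} → CoMatching G X → P4Free G X
  CoMatching⇒P4Free comatching a _ c d Xa _ Xc Xd _ _ cd ac _ ad =
    Adj⇒≢ G cd (comatching a c d Xa Xc Xd a≢c a≢d ac ad)
    where
    a≢c : a ≢ c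
    a≢c refl = true≢false cd ad
    a≢d : a ≢ d
    a≢d refl = true≢false cd (NonAdj-sym G ac)

  Stable3⇒VertexPlusCoMatching : ∀ {C} → Stable3 G C → VertexPlusCoMatching G C
  Stable3⇒VertexPlusCoMatching {C} (a , b , c , _ , (Ca , _ , _) , within , (ab , ac , _)) =
    a , Ca , a-isolated , comatching
    where
    other : ∀ v → C v → v ≢ a → v ≡ b ⊎ v ≡ c
    other v Cv v≢a with within v Cv
    ... | inj₁ v≡a = ⊥-elim (v≢a v≡a)
    ... | inj₂ v≡b⊎c = v≡b⊎c
    a-isolated : ∀ v → C v → v ≢ a → NonAdj G a v
    a-isolated v Cv v≢a with other v Cv v≢a
    ... | inj₁ refl = ab
    ... | inj₂ refl = ac
    comatching : CoMatching G (λ v → C v × v ≢ a)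
    comatching u v w (Cu , u≢a) (Cv , v≢a) (Cw , w≢a) u≢v u≢w _ _
      with other u Cu u≢a | other v Cv v≢a | other w Cw w≢a
    ... | _ | inj₁ refl | inj₁ refl = refl
    ... | _ | inj₂ refl | inj₂ refl = refl
    ... | inj₁ refl | inj₁ refl | _ = ⊥-elim (u≢v refl)
    ... | inj₂ refl | inj₂ refl | _ = ⊥-elim (u≢v refl)
    ... | inj₁ refl | _ | inj₁ refl = ⊥-elim (u≢w refl)
    ... | inj₂ refl | _ | inj₂ refl = ⊥-elim (u≢w refl)

walk-start : ∀ {k} {X : VSet k} {R a b} → Walk X R a b → X a
walk-start (here Xa) = Xa
walk-start (step Xa _ _) = Xa

module _ (G : Graph) {X : VSet (n G)} (X? : ∀ v → Dec (X v)) (4K₁-free : Free 4K₁ G X)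
         (K₂+2K₁-free : Free K₂+2K₁ G X) (2K₂-free : Free 2K₂ G X) (P₄-free : P4Free G X) where

  private
    CoAdj-sym : ∀ {a b} → CoAdj G a b → CoAdj G b a
    CoAdj-sym (a≢b , ab) = a≢b ∘ sym , NonAdj-sym G ab

  co-path-with-chord : ∀ {a b c d} → X a → X b → X c → X d →
                       CoAdj G a b → CoAdj G b c → CoAdj G c d → Adj G a c → Adj G b d → ⊥
  co-path-with-chord {a} {b} {c} {d} Xa Xb Xc Xd (a≢b , ab) (b≢c , bc) (c≢d , cd) ac bd
    with Adj⊎NonAdj G a d
  ... | inj₁ ad = P₄-free c a d b Xc Xa Xd Xb (Adj-sym G ac) ad (Adj-sym G bd) cd ab (NonAdj-sym G bc)
  ... | inj₂ ad = 2K₂-free (embed₄ G X Xa Xc Xb Xd (Adj⇒≢ G ac) a≢b a≢d (b≢c ∘ sym) c≢d (Adj⇒≢ G bd)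
                                   ac ab ad (NonAdj-sym G bc) cd bd)
    where
    a≢d : a ≢ d
    a≢d refl = true≢false ac (NonAdj-sym G cd)

  InCoStar : Fin (n G) → Fin (n G) → Set
  InCoStar w y = y ≡ w ⊎ CoAdj G w y

  CoStarClosed : Fin (n G) → Set
  CoStarClosed w = ∀ {y z} → X y → X z → InCoStar w y → CoAdj G y z → InCoStar w z

  private
    grow : ∀ {w y z} → InCoStar w y → ¬ Adj G w z → CoAdj G y z → InCoStar w z
    grow (inj₁ refl) _ yz = inj₂ yz
    grow {w} {z = z} (inj₂ _) ¬wz _ with z ≟ w | Adj⊎NonAdj G w z
    ... | yes z≡w | _ = inj₁ z≡w
    ... | no z≢w | inj₂ wz = inj₂ (z≢w ∘ sym , wz)
    ... | no _ | inj₁ wz = ⊥-elim (¬wz wz)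

  -- A centre is a vertex whose co-star is closed under co-adjacency.  This is u itself, unless some
  -- co-path u – v – z has adjacent ends; then it is v.
  find-centre : ∀ u → X u → Σ (Fin (n G)) λ w → X w × Walk X (CoAdj G) u w × InCoStar w u × CoStarClosed w
  find-centre u Xu with any? (λ v → any? λ z → X? v ×-dec X? z ×-dec (¬? (u ≟ v) ×-dec (adj G u v ≟ᵇ false)) ×-dec
                                          (¬? (v ≟ z) ×-dec (adj G v z ≟ᵇ false)) ×-dec (adj G u z ≟ᵇ true))
  ... | no ¬co-path = u , Xu , here Xu , inj₁ refl , closed
    where
    closed : CoStarClosed u
    closed _ _ (inj₁ refl) yz = inj₂ yz
    closed {y} {z} Xy Xz (inj₂ uy) yz =
      grow (inj₂ uy) (λ uz → ¬co-path (y , z , Xy , Xz , uy , yz , uz)) yz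
  ... | yes (v , z , Xv , Xz , uv , vz , uz) = v , Xv , step Xu uv (here Xv) , inj₂ (CoAdj-sym uv) , closed
    where
    closed : CoStarClosed v
    closed _ _ (inj₁ refl) yz' = inj₂ yz'
    closed {y} {z'} Xy Xz' (inj₂ vy) yz' = grow (inj₂ vy) (two-co-paths Xy Xz' vy yz') yz'
      where
      two-co-paths : ∀ {y z'} → X y → X z' → CoAdj G v y → CoAdj G y z' → ¬ Adj G v z'
      two-co-paths {y} {z'} Xy Xz' vy yz' vz' with Adj⊎NonAdj G y u
      ... | inj₁ yu = co-path-with-chord Xz' Xy Xv Xu (CoAdj-sym yz') (CoAdj-sym vy) (CoAdj-sym uv) (Adj-sym G vz') yu
      ... | inj₂ yu with Adj⊎NonAdj G y z
      ...   | inj₁ yz = co-path-with-chord Xz' Xy Xv Xz (CoAdj-sym yz') (CoAdj-sym vy) vz (Adj-sym G vz') yz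
      ...   | inj₂ yz = K₂+2K₁-free (embed₄ G X Xu Xz Xv Xy (Adj⇒≢ G uz) (proj₁ uv) u≢y (proj₁ vz ∘ sym) z≢y (proj₁ vy)
                                              uz (proj₂ uv) (NonAdj-sym G yu) (NonAdj-sym G (proj₂ vz)) (NonAdj-sym G yz) (proj₂ vy))
        where
        u≢y : u ≢ y
        u≢y refl = true≢false uz yz
        z≢y : z ≢ y
        z≢y refl = true≢false uz (NonAdj-sym G yu)

  free⇒VertexPlusCoMatching : EachCoComponent VertexPlusCoMatching G X
  free⇒VertexPlusCoMatching u Xu with find-centre u Xu
  ... | w , Xw , u→w , u-near , closed = w , (Xw , u→w) , w-isolated , comatching
    where
    near : ∀ {a b} → InCoStar w a → Walk X (CoAdj G) a b → InCoStar w b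
    near a-near (here _) = a-near
    near a-near (step Xa ab rest) = near (closed Xa (walk-start rest) a-near ab) rest
    w-isolated : ∀ v → CoComponent G X u v → v ≢ w → NonAdj G w v
    w-isolated v (_ , u→v) v≢w with near u-near u→v
    ... | inj₁ v≡w = ⊥-elim (v≢w v≡w)
    ... | inj₂ (_ , wv) = wv
    comatching : CoMatching G (λ v → CoComponent G X u v × v ≢ w)
    comatching a b c (Ca , a≢w) (Cb , b≢w) (Cc , c≢w) a≢b a≢c ab ac with b ≟ c
    ... | yes b≡c = b≡c
    ... | no b≢c with Adj⊎NonAdj G b c
    ...   | inj₂ bc = ⊥-elim (4K₁-free (embed₄ G X Xw (proj₁ Ca) (proj₁ Cb) (proj₁ Cc)
                          (a≢w ∘ sym) (b≢w ∘ sym) (c≢w ∘ sym) a≢b a≢c b≢c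
                          (w-isolated a Ca a≢w) (w-isolated b Cb b≢w) (w-isolated c Cc c≢w) ab ac bc))
    ...   | inj₁ bc = ⊥-elim (K₂+2K₁-free (embed₄ G X (proj₁ Cb) (proj₁ Cc) Xw (proj₁ Ca)
                          b≢c b≢w (a≢b ∘ sym) c≢w (a≢c ∘ sym) (a≢w ∘ sym)
                          bc (NonAdj-sym G (w-isolated b Cb b≢w)) (NonAdj-sym G ab)
                          (NonAdj-sym G (w-isolated c Cc c≢w)) (NonAdj-sym G ac) (w-isolated a Ca a≢w)))

module _ (G : Graph) {X : VSet (n G)} (structured : EachCoComponent VertexPlusCoMatching G X) where

  private
    centre : ∀ {u} → X u → Fin (n G)
    centre {u} Xu = proj₁ (structured u Xu)

    centre-isolated : ∀ {u} (Xu : X u) {v} → CoComponent G X u v → v ≢ centre Xu → NonAdj G (centre Xu) v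
    centre-isolated {u} Xu {v} = proj₁ (proj₂ (proj₂ (structured u Xu))) v

    not-centre : ∀ {u} (Xu : X u) {a b} → CoComponent G X u a → CoComponent G X u b → Adj G a b → a ≢ centre Xu
    not-centre Xu {a} {b} Ca Cb ab refl with b ≟ a
    ... | yes refl = true≢false ab (adj-irrefl G a)
    ... | no b≢a = true≢false ab (centre-isolated Xu Cb b≢a)

    reach₀ : ∀ {u} → X u → CoComponent G X u u
    reach₀ Xu = Xu , here Xu

    reach₁ : ∀ {u v} → X u → X v → u ≢ v → NonAdj G u v → CoComponent G X u v
    reach₁ Xu Xv u≢v uv = Xv , step Xu (u≢v , uv) (here Xv)

    reach₂ : ∀ {u v w} → X u → X v → X w → u ≢ v → NonAdj G u v → v ≢ w → NonAdj G v w → CoComponent G X u w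
    reach₂ Xu Xv Xw u≢v uv v≢w vw = Xw , step Xu (u≢v , uv) (step Xv (v≢w , vw) (here Xw))

    three-co-neighbours : ∀ {u} (Xu : X u) {a b c} → CoComponent G X u a → CoComponent G X u b → CoComponent G X u c →
                          a ≢ centre Xu → b ≢ centre Xu → c ≢ centre Xu → a ≢ b → a ≢ c → b ≢ c →
                          NonAdj G a b → NonAdj G a c → ⊥
    three-co-neighbours {u} Xu Ca Cb Cc a≢w b≢w c≢w a≢b a≢c b≢c ab ac =
      b≢c (proj₂ (proj₂ (proj₂ (structured u Xu))) _ _ _ (Ca , a≢w) (Cb , b≢w) (Cc , c≢w) a≢b a≢c ab ac)

  VertexPlusCoMatching⇒4K₁-free : Free 4K₁ G X
  VertexPlusCoMatching⇒4K₁-free (f , fX , f-inj , f-adj) = by-centre (f 0F ≟ w) (f 1F ≟ w) (f 2F ≟ w)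
    where
    X₀ : X (f 0F)
    X₀ = fX 0F tt
    w : Fin (n G)
    w = centre X₀
    d : ∀ {i j} → i ≢ j → f i ≢ f j
    d i≢j = i≢j ∘ f-inj _ _ tt tt
    ≢w : ∀ {i j} → f i ≡ w → j ≢ i → f j ≢ w
    ≢w fi≡w j≢i fj≡w = d j≢i (trans fj≡w (sym fi≡w))
    C : ∀ i → CoComponent G X (f 0F) (f i)
    C 0F = reach₀ X₀
    C 1F = reach₁ X₀ (fX 1F tt) (d (λ ())) (f-adj 0F 1F tt tt)
    C 2F = reach₁ X₀ (fX 2F tt) (d (λ ())) (f-adj 0F 2F tt tt)
    C 3F = reach₁ X₀ (fX 3F tt) (d (λ ())) (f-adj 0F 3F tt tt)
    by-centre : Dec (f 0F ≡ w) → Dec (f 1F ≡ w) → Dec (f 2F ≡ w) → ⊥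
    by-centre (yes x≡w) _ _ = three-co-neighbours X₀ (C 1F) (C 2F) (C 3F) (≢w x≡w (λ ())) (≢w x≡w (λ ())) (≢w x≡w (λ ()))
                                (d (λ ())) (d (λ ())) (d (λ ())) (f-adj 1F 2F tt tt) (f-adj 1F 3F tt tt)
    by-centre (no x≢w) (yes y≡w) _ = three-co-neighbours X₀ (C 0F) (C 2F) (C 3F) x≢w (≢w y≡w (λ ())) (≢w y≡w (λ ()))
                                (d (λ ())) (d (λ ())) (d (λ ())) (f-adj 0F 2F tt tt) (f-adj 0F 3F tt tt)
    by-centre (no x≢w) (no y≢w) (yes z≡w) = three-co-neighbours X₀ (C 0F) (C 1F) (C 3F) x≢w y≢w (≢w z≡w (λ ()))
                                (d (λ ())) (d (λ ())) (d (λ ())) (f-adj 0F 1F tt tt) (f-adj 0F 3F tt tt)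
    by-centre (no x≢w) (no y≢w) (no z≢w) = three-co-neighbours X₀ (C 0F) (C 1F) (C 2F) x≢w y≢w z≢w
                                (d (λ ())) (d (λ ())) (d (λ ())) (f-adj 0F 1F tt tt) (f-adj 0F 2F tt tt)

  VertexPlusCoMatching⇒K₂+2K₁-free : Free K₂+2K₁ G X
  VertexPlusCoMatching⇒K₂+2K₁-free (f , fX , f-inj , f-adj) = by-centre (f 2F ≟ w)
    where
    X₂ : X (f 2F)
    X₂ = fX 2F tt
    w : Fin (n G)
    w = centre X₂
    d : ∀ {i j} → i ≢ j → f i ≢ f j
    d i≢j = i≢j ∘ f-inj _ _ tt tt
    C₀ : CoComponent G X (f 2F) (f 0F)
    C₀ = reach₁ X₂ (fX 0F tt) (d (λ ())) (f-adj 2F 0F tt tt)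
    C₁ : CoComponent G X (f 2F) (f 1F)
    C₁ = reach₁ X₂ (fX 1F tt) (d (λ ())) (f-adj 2F 1F tt tt)
    C₃ : CoComponent G X (f 2F) (f 3F)
    C₃ = reach₁ X₂ (fX 3F tt) (d (λ ())) (f-adj 2F 3F tt tt)
    x≢w : f 0F ≢ w
    x≢w = not-centre X₂ C₀ C₁ (f-adj 0F 1F tt tt)
    y≢w : f 1F ≢ w
    y≢w = not-centre X₂ C₁ C₀ (f-adj 1F 0F tt tt)
    by-centre : Dec (f 2F ≡ w) → ⊥
    by-centre (yes z≡w) = three-co-neighbours X₂ C₃ C₀ C₁ (λ w'≡w → d (λ ()) (trans w'≡w (sym z≡w))) x≢w y≢w
                            (d (λ ())) (d (λ ())) (d (λ ())) (f-adj 3F 0F tt tt) (f-adj 3F 1F tt tt)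
    by-centre (no z≢w) = three-co-neighbours X₂ (reach₀ X₂) C₀ C₁ z≢w x≢w y≢w
                            (d (λ ())) (d (λ ())) (d (λ ())) (f-adj 2F 0F tt tt) (f-adj 2F 1F tt tt)

  VertexPlusCoMatching⇒2K₂-free : Free 2K₂ G X
  VertexPlusCoMatching⇒2K₂-free (f , fX , f-inj , f-adj) =
    three-co-neighbours X₀ (reach₀ X₀) C₂ C₃
      (not-centre X₀ (reach₀ X₀) C₁ (f-adj 0F 1F tt tt)) (not-centre X₀ C₂ C₃ (f-adj 2F 3F tt tt))
      (not-centre X₀ C₃ C₂ (f-adj 3F 2F tt tt))
      (d (λ ())) (d (λ ())) (d (λ ())) (f-adj 0F 2F tt tt) (f-adj 0F 3F tt tt)
    where
    X₀ : X (f 0F)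
    X₀ = fX 0F tt
    d : ∀ {i j} → i ≢ j → f i ≢ f j
    d i≢j = i≢j ∘ f-inj _ _ tt tt
    C₂ : CoComponent G X (f 0F) (f 2F)
    C₂ = reach₁ X₀ (fX 2F tt) (d (λ ())) (f-adj 0F 2F tt tt)
    C₃ : CoComponent G X (f 0F) (f 3F)
    C₃ = reach₁ X₀ (fX 3F tt) (d (λ ())) (f-adj 0F 3F tt tt)
    C₁ : CoComponent G X (f 0F) (f 1F)
    C₁ = reach₂ X₀ (fX 2F tt) (fX 1F tt) (d (λ ())) (f-adj 0F 2F tt tt) (d (λ ())) (f-adj 2F 1F tt tt)

  VertexPlusCoMatching⇒P4Free : P4Free G X
  VertexPlusCoMatching⇒P4Free a b c d Xa Xb Xc Xd ab _ cd ac bd ad =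
    three-co-neighbours Xa (reach₀ Xa) Cc Cd (not-centre Xa (reach₀ Xa) Cb ab) (not-centre Xa Cc Cd cd)
      (not-centre Xa Cd Cc (Adj-sym G cd)) a≢c a≢d (Adj⇒≢ G cd) ac ad
    where
    a≢c : a ≢ c
    a≢c refl = true≢false cd ad
    a≢d : a ≢ d
    a≢d refl = true≢false cd (NonAdj-sym G ac)
    d≢b : d ≢ b
    d≢b refl = true≢false ab ad
    Cc : CoComponent G X a c
    Cc = reach₁ Xa Xc a≢c ac
    Cd : CoComponent G X a d
    Cd = reach₁ Xa Xd a≢d ad
    Cb : CoComponent G X a b
    Cb = reach₂ Xa Xd Xb a≢d ad d≢b (NonAdj-sym G bd)

indicator : ∀ {A : Set} → Dec A → ℕ
indicator a? = if does a? then 1 else 0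

count : ∀ {N} {P : Fin N → Set} → Decidable P → ℕ
count {N} P? = ∑[ v < N ] indicator (P? v)

∑-const : ∀ k c → ∑[ i < k ] c ≡ k * c
∑-const ℕ.zero _ = refl
∑-const (ℕ.suc k) c = cong (c +_) (∑-const k c)

∑-mono-≤ : ∀ {k} {f g : Fin k → ℕ} → (∀ i → f i ≤ g i) → ∑[ i < k ] f i ≤ ∑[ i < k ] g i
∑-mono-≤ {ℕ.zero} _ = z≤n
∑-mono-≤ {ℕ.suc _} f≤g = +-mono-≤ (f≤g zero) (∑-mono-≤ (f≤g ∘ suc))

∑-indicator≡1 : ∀ {k} (x : Fin k) → ∑[ i < k ] indicator (x ≟ i) ≡ 1
∑-indicator≡1 {ℕ.suc k} zero = cong ℕ.suc (trans (∑-const k 0) (*-zeroʳ k))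
∑-indicator≡1 {ℕ.suc _} (suc x) = ∑-indicator≡1 x

∑-count-parts : ∀ {N k} (q : Fin N → Fin k) → ∑[ i < k ] count (λ v → q v ≟ i) ≡ N
∑-count-parts {N} q =
  trans (sym (∑-comm (λ v i → indicator (q v ≟ i))))
        (trans (sum-cong-≗ (∑-indicator≡1 ∘ q)) (trans (∑-const N 1) (*-identityʳ N)))

witnesses : ∀ {N k} {P : Fin N → Set} (P? : Decidable P) → k ≤ count P? →
            Σ (Fin k → Fin N) λ f → (∀ i j → f i ≡ f j → i ≡ j) × (∀ i → P (f i))
witnesses {ℕ.zero} {ℕ.zero} _ _ = (λ ()) , (λ ()) , (λ ())
witnesses {ℕ.suc N} {k} P? k≤count with P? zero
witnesses {ℕ.suc _} {ℕ.zero} _ _ | yes _ = (λ ()) , (λ ()) , (λ ())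
witnesses {ℕ.suc N} {ℕ.suc k} {P} P? (s≤s k≤count) | yes P0 with witnesses (P? ∘ suc) k≤count
... | f , f-inj , Pf = g , g-inj , Pg
  where
  g : Fin (ℕ.suc k) → Fin (ℕ.suc N)
  g zero = zero
  g (suc i) = suc (f i)
  g-inj : ∀ i j → g i ≡ g j → i ≡ j
  g-inj zero zero _ = refl
  g-inj (suc i) (suc j) e = cong suc (f-inj i j (suc-injective e))
  Pg : ∀ i → P (g i)
  Pg zero = P0
  Pg (suc i) = Pf i
witnesses {ℕ.suc N} P? k≤count | no _ with witnesses (P? ∘ suc) k≤count
... | f , f-inj , Pf = suc ∘ f , (λ i j e → f-inj i j (suc-injective e)) , Pf

count-≤ : ∀ {N k} {P : Fin N → Set} (P? : Decidable P) →
          (∀ (f : Fin (ℕ.suc k) → Fin N) → (∀ i j → f i ≡ f j → i ≡ j) → (∀ i → P (f i)) → ⊥) → count P? ≤ k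
count-≤ {k = k} P? none with count P? ≤? k
... | yes count≤k = count≤k
... | no count≰k with witnesses P? (≰⇒> count≰k)
...   | f , f-inj , Pf = ⊥-elim (none f f-inj Pf)

-- Covering a spiking by cliques and two comatchings

three-into-two : ∀ {A : Set} {a b : A} (f : Fin 3 → A) → (∀ i j → f i ≡ f j → i ≡ j) → (∀ i → f i ≡ a ⊎ f i ≡ b) → ⊥
three-into-two {a = a} {b} f f-inj f∈ = by-values (f∈ 0F) (f∈ 1F) (f∈ 2F)
  where
  clash : ∀ i j → i ≢ j → f i ≡ f j → ⊥
  clash i j i≢j = i≢j ∘ f-inj i j
  by-values : f 0F ≡ a ⊎ f 0F ≡ b → f 1F ≡ a ⊎ f 1F ≡ b → f 2F ≡ a ⊎ f 2F ≡ b → ⊥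
  by-values (inj₁ e₀) (inj₁ e₁) _ = clash 0F 1F (λ ()) (trans e₀ (sym e₁))
  by-values (inj₂ e₀) (inj₂ e₁) _ = clash 0F 1F (λ ()) (trans e₀ (sym e₁))
  by-values (inj₁ e₀) _ (inj₁ e₂) = clash 0F 2F (λ ()) (trans e₀ (sym e₂))
  by-values (inj₂ e₀) _ (inj₂ e₂) = clash 0F 2F (λ ()) (trans e₀ (sym e₂))
  by-values _ (inj₁ e₁) (inj₁ e₂) = clash 1F 2F (λ ()) (trans e₁ (sym e₂))
  by-values _ (inj₂ e₁) (inj₂ e₂) = clash 1F 2F (λ ()) (trans e₁ (sym e₂))

module _ {G : Graph} {X : VSet (n G)} (triangle-free : TriangleFree G) where

  clique-has-≤2 : Clique G X → (f : Fin 3 → Fin (n G)) → (∀ i j → f i ≡ f j → i ≡ j) → (∀ i → X (f i)) → ⊥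
  clique-has-≤2 clique f f-inj fX = triangle-free (f 0F) (f 1F) (f 2F) (adjacent 0F 1F (λ ())) (adjacent 1F 2F (λ ())) (adjacent 0F 2F (λ ()))
    where
    adjacent : ∀ i j → i ≢ j → Adj G (f i) (f j)
    adjacent i j i≢j = clique (f i) (f j) (fX i) (fX j) (i≢j ∘ f-inj i j)

  module _ (square-free : SquareFree G) (comatching : CoMatching G X) (f : Fin 4 → Fin (n G))
           (f-inj : ∀ i j → f i ≡ f j → i ≡ j) (fX : ∀ i → X (f i)) where
    private
      d : ∀ {i j} → i ≢ j → f i ≢ f j
      d i≢j = i≢j ∘ f-inj _ _
      two-non-neighbours : ∀ i j k → i ≢ j → i ≢ k → j ≢ k → NonAdj G (f i) (f j) → NonAdj G (f i) (f k) → ⊥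
      two-non-neighbours i j k i≢j i≢k j≢k ij ik = d j≢k (comatching (f i) (f j) (f k) (fX i) (fX j) (fX k) (d i≢j) (d i≢k) ij ik)
      two-neighbours : ∀ a b c e → a ≢ e → b ≢ c → b ≢ e → c ≢ e → Adj G (f a) (f b) → Adj G (f a) (f c) → ⊥
      two-neighbours a b c e a≢e b≢c b≢e c≢e ab ac with Adj⊎NonAdj G (f b) (f c)
      ... | inj₁ bc = triangle-free (f a) (f b) (f c) ab bc ac
      ... | inj₂ bc with Adj⊎NonAdj G (f b) (f e)
      ...   | inj₂ be = two-non-neighbours b c e b≢c b≢e c≢e bc be
      ...   | inj₁ be with Adj⊎NonAdj G (f c) (f e)
      ...     | inj₂ ce = two-non-neighbours c b e (b≢c ∘ sym) c≢e b≢e (NonAdj-sym G bc) ce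
      ...     | inj₁ ce with Adj⊎NonAdj G (f a) (f e)
      ...       | inj₁ ae = triangle-free (f a) (f b) (f e) ab be ae
      ...       | inj₂ ae = square-free (f a) (f b) (f e) (f c) ab be (Adj-sym G ce) (Adj-sym G ac) (d a≢e) (d b≢c)

    comatching-has-≤3 : ⊥
    comatching-has-≤3
      with Adj⊎NonAdj G (f 0F) (f 1F) | Adj⊎NonAdj G (f 0F) (f 2F) | Adj⊎NonAdj G (f 0F) (f 3F)
    ... | inj₁ ab | inj₁ ac | _ = two-neighbours 0F 1F 2F 3F (λ ()) (λ ()) (λ ()) (λ ()) ab ac
    ... | inj₁ ab | inj₂ _ | inj₁ ad = two-neighbours 0F 1F 3F 2F (λ ()) (λ ()) (λ ()) (λ ()) ab ad
    ... | inj₂ _ | inj₁ ac | inj₁ ad = two-neighbours 0F 2F 3F 1F (λ ()) (λ ()) (λ ()) (λ ()) ac ad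
    ... | inj₁ _ | inj₂ ac | inj₂ ad = two-non-neighbours 0F 2F 3F (λ ()) (λ ()) (λ ()) ac ad
    ... | inj₂ ab | inj₁ _ | inj₂ ad = two-non-neighbours 0F 1F 3F (λ ()) (λ ()) (λ ()) ab ad
    ... | inj₂ ab | inj₂ ac | _ = two-non-neighbours 0F 1F 2F (λ ()) (λ ()) (λ ()) ab ac

module _ (T : Graph) {m : ℕ} (size : n T ≡ 3 + m) (triangle-free : TriangleFree T) (square-free : SquareFree T)
         (q : Fin (n T + n T) → Fin (2 + m)) where

  open Spiking T

  private
    S : Graph
    S = spiking T

    spike-partner : ∀ {i x y w} → CoMatching S (Part q i) → x ≢ y → q (spike x) ≡ i → q (spike y) ≡ i → q w ≡ i →
                    w ≢ spike x → w ≢ spike y → w ≡ base x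
    spike-partner {i} {x} {y} {w} comatching x≢y qx qy qw w≢x w≢y with Adj⊎NonAdj S (spike x) w
    ... | inj₁ xw = spike-neighbour x w xw
    ... | inj₂ xw = ⊥-elim (w≢y (sym (comatching (spike x) (spike y) w qx qy qw (x≢y ∘ spike-injective) (w≢x ∘ sym)
                                                  (adj-spike-spike x y) xw)))

    two-spikes-fill : ∀ {i x y} → CoMatching S (Part q i) → x ≢ y → q (spike x) ≡ i → q (spike y) ≡ i →
                      ∀ w → q w ≡ i → w ≡ spike x ⊎ w ≡ spike y
    two-spikes-fill {x = x} {y} comatching x≢y qx qy w qw with w ≟ spike x | w ≟ spike y
    ... | yes w≡x | _ = inj₁ w≡x
    ... | no _ | yes w≡y = inj₂ w≡y
    ... | no w≢x | no w≢y = ⊥-elim (x≢y (base-injective (trans (sym (spike-partner comatching x≢y qx qy qw w≢x w≢y))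
                                                               (spike-partner comatching (x≢y ∘ sym) qy qx qw w≢y w≢x))))

    shared-part-overfull : ∀ {i i'} → CoMatching S (Part q i) → CoMatching S (Part q i') →
              (∀ l → l ≢ i → l ≢ i' → Clique S (Part q l)) → ∀ {x y} → x ≢ y → q (spike x) ≡ i → q (spike y) ≡ i → ⊥
    shared-part-overfull {i} {i'} comatching comatching' cliques {x} {y} x≢y qx qy = <-irrefl refl overfull
      where
      in-part : ∀ l v → Dec (q v ≡ l)
      in-part l v = q v ≟ l
      part-size bound : Fin (2 + m) → ℕ
      part-size l = count (in-part l)
      bound l = 2 + indicator (i' ≟ l)
      part-size≤bound : ∀ l → part-size l ≤ bound l
      part-size≤bound l with i' ≟ l
      ... | yes refl = count-≤ (in-part i') (comatching-has-≤3 {S} (spiking-TriangleFree triangle-free) (spiking-SquareFree square-free) comatching')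
      ... | no i'≢l with l ≟ i
      ...   | yes refl = count-≤ (in-part i) λ f f-inj fq → three-into-two f f-inj λ k → two-spikes-fill comatching x≢y qx qy (f k) (fq k)
      ...   | no l≢i = count-≤ (in-part l) (clique-has-≤2 {S} (spiking-TriangleFree triangle-free) (cliques l l≢i (i'≢l ∘ sym)))
      capacity : ∑[ l < 2 + m ] bound l ≡ (2 + m) * 2 + 1
      capacity = trans (∑-distrib-+ (λ _ → 2) (λ l → indicator (i' ≟ l))) (cong₂ _+_ (∑-const (2 + m) 2) (∑-indicator≡1 i'))
      overfull : (2 + m) * 2 + 1 < (2 + m) * 2 + 1
      overfull = begin-strict
        (2 + m) * 2 + 1              <⟨ n<1+n _ ⟩
        1 + ((2 + m) * 2 + 1)        ≡⟨ arithmetic m ⟩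
        (3 + m) + (3 + m)            ≡⟨ sym (cong₂ _+_ size size) ⟩
        n T + n T                    ≡⟨ sym (∑-count-parts q) ⟩
        ∑[ l < 2 + m ] part-size l   ≤⟨ ∑-mono-≤ part-size≤bound ⟩
        ∑[ l < 2 + m ] bound l       ≡⟨ capacity ⟩
        (2 + m) * 2 + 1              ∎
        where
        open Data.Nat.Properties.≤-Reasoning
        open +-*-Solver
        arithmetic : ∀ m → 1 + ((2 + m) * 2 + 1) ≡ (3 + m) + (3 + m)
        arithmetic = solve 1 (λ m → con 1 :+ ((con 2 :+ m) :* con 2 :+ con 1) := (con 3 :+ m) :+ (con 3 :+ m)) refl

  -- Two spikes share a part, which must be a comatching and then holds nothing else; the other parts
  -- hold at most three (the other comatching) or two (the cliques) vertices: too few for V(S).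
  cliques-and-two-comatchings-cannot-cover : ∀ {c₁ c₂} → CoMatching S (Part q c₁) → CoMatching S (Part q c₂) →
                                             (∀ i → i ≢ c₁ → i ≢ c₂ → Clique S (Part q i)) → ⊥
  cliques-and-two-comatchings-cannot-cover {c₁} {c₂} comatching₁ comatching₂ cliques
    with pigeonhole (≤-reflexive (sym size)) (q ∘ spike)
  ... | x , y , x<y , same with q (spike x) ≟ c₁ | q (spike x) ≟ c₂
  ...   | yes qx | _ = shared-part-overfull comatching₁ comatching₂ cliques (<⇒≢ x<y) qx (trans (sym same) qx)
  ...   | no _ | yes qx = shared-part-overfull comatching₂ comatching₁ (λ i i≢c₂ i≢c₁ → cliques i i≢c₁ i≢c₂)
                            (<⇒≢ x<y) qx (trans (sym same) qx)
  ...   | no qx≢c₁ | no qx≢c₂ = true≢false (cliques _ qx≢c₁ qx≢c₂ (spike x) (spike y) refl (sym same)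
                                                     (<⇒≢ x<y ∘ spike-injective)) (adj-spike-spike x y)

-- Covering a spiking by cliques and a restricted part

module _ (T : Graph) {m : ℕ} (size : n T ≡ 3 + m) (triangle-free : TriangleFree T)
         (q : Fin (n T + n T) → Fin (2 + m)) (cliques : ∀ i → i ≢ zero → Clique (spiking T) (Part q i))
         (4K₁-free : Free 4K₁ (spiking T) (Part q zero)) (K₂+2K₁-free : Free K₂+2K₁ (spiking T) (Part q zero))
         (2K₂-free : Free 2K₂ (spiking T) (Part q zero)) (P₄-free : P4Free (spiking T) (Part q zero)) where

  open Spiking T

  private
    S : Graph
    S = spiking T

  -- Pigeonhole on slot ∘ kind (t base vertices, t − 1 parts) yields a Double.  Sending one vertex of
  -- the double to part zero and applying pigeonhole again yields a second collision, which a
  -- forbidden subgraph of part zero or a triangle in a clique part rules out.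
  data Kind (x : Fin (n T)) : Set where
    outer : q (spike x) ≢ zero → Kind x
    hanging : q (spike x) ≡ zero → q (base x) ≢ zero → Kind x
    inner : q (spike x) ≡ zero → q (base x) ≡ zero → Kind x

  kind : ∀ x → Kind x
  kind x with q (spike x) ≟ zero | q (base x) ≟ zero
  ... | no s≢0 | _ = outer s≢0
  ... | yes s≡0 | no b≢0 = hanging s≡0 b≢0
  ... | yes s≡0 | yes b≡0 = inner s≡0 b≡0

  slot : ∀ {x} → Kind x → Fin (2 + m)
  slot {x} (outer _) = q (spike x)
  slot {x} (hanging _ _) = q (base x)
  slot (inner _ _) = zero

  Double : Fin (n T) → Fin (n T) → Set
  Double x y = x ≢ y × q (spike x) ≡ zero × q (spike y) ≡ zero × q (base x) ≢ zero × q (base x) ≡ q (base y)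

  private
    adjacent-in-part : ∀ {u v} → q u ≡ q v → q u ≢ zero → u ≢ v → Adj S u v
    adjacent-in-part {u} {v} same u≢0 u≢v = cliques (q u) u≢0 u v refl (sym same) u≢v

    spike-in-two-parts : ∀ {x y} → x ≢ y → q (spike x) ≡ q (base y) → q (spike x) ≢ zero → ⊥
    spike-in-two-parts {x} {y} x≢y same s≢0 =
      x≢y (sym (base-injective (spike-neighbour x (base y) (adjacent-in-part same s≢0 (base≢spike y x ∘ sym)))))

    inner-pair : ∀ {x y} → x ≢ y → q (spike x) ≡ zero → q (base x) ≡ zero → q (spike y) ≡ zero → q (base y) ≡ zero → ⊥
    inner-pair {x} {y} x≢y sx bx sy by with Adj⊎NonAdj S (base x) (base y)
    ... | inj₁ bxby = P₄-free (spike x) (base x) (base y) (spike y) sx bx by sy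
                        (spike-base-adjacent x) bxby (base-spike-adjacent y)
                        (spike-base-nonadjacent x≢y) (base-spike-nonadjacent x≢y) (adj-spike-spike x y)
    ... | inj₂ bxby = 2K₂-free (embed₄ S (Part q zero) sx bx sy by
                        (base≢spike x x ∘ sym) (x≢y ∘ spike-injective) (base≢spike y x ∘ sym) (base≢spike x y)
                        (x≢y ∘ base-injective) (base≢spike y y ∘ sym)
                        (spike-base-adjacent x) (adj-spike-spike x y) (spike-base-nonadjacent x≢y)
                        (base-spike-nonadjacent x≢y) bxby (spike-base-adjacent y))

  collision⇒Double : ∀ {x y} → x ≢ y → (kx : Kind x) (ky : Kind y) → slot kx ≡ slot ky → Double x y
  collision⇒Double x≢y (outer sx) (outer _) same =
    ⊥-elim (true≢false (adjacent-in-part same sx (x≢y ∘ spike-injective)) (adj-spike-spike _ _))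
  collision⇒Double x≢y (outer sx) (hanging _ _) same = ⊥-elim (spike-in-two-parts x≢y same sx)
  collision⇒Double _ (outer sx) (inner _ _) same = ⊥-elim (sx same)
  collision⇒Double x≢y (hanging _ _) (outer sy) same = ⊥-elim (spike-in-two-parts (x≢y ∘ sym) (sym same) sy)
  collision⇒Double x≢y (hanging sx bx) (hanging sy _) same = x≢y , sx , sy , bx , same
  collision⇒Double _ (hanging _ bx) (inner _ _) same = ⊥-elim (bx same)
  collision⇒Double _ (inner _ _) (outer sy) same = ⊥-elim (sy (sym same))
  collision⇒Double _ (inner _ _) (hanging _ by) same = ⊥-elim (by (sym same))
  collision⇒Double x≢y (inner sx bx) (inner sy by) _ = ⊥-elim (inner-pair x≢y sx bx sy by)

  private
    two-doubles : ∀ {x y x' y'} → Double x y → Double x' y' → x' ≢ x → y' ≢ x → ⊥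
    two-doubles {x} {y} {x'} {y'} (x≢y , sx , sy , bx≢0 , bx≡by) (x'≢y' , sx' , sy' , _ , bx'≡by') x'≢x y'≢x
      with q (base x) ≟ q (base x')
    ... | yes bx≡bx' = three-bases (x'≢y' ∘ sym)
      where
      in-K : ∀ {z} → z ≡ x ⊎ z ≡ y ⊎ z ≡ x' ⊎ z ≡ y' → q (base z) ≡ q (base x)
      in-K (inj₁ refl) = refl
      in-K (inj₂ (inj₁ refl)) = sym bx≡by
      in-K (inj₂ (inj₂ (inj₁ refl))) = sym bx≡bx'
      in-K (inj₂ (inj₂ (inj₂ refl))) = trans (sym bx'≡by') (sym bx≡bx')
      adjacent : ∀ {u v} → q (base u) ≡ q (base x) → q (base v) ≡ q (base x) → u ≢ v → Adj S (base u) (base v)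
      adjacent Ku Kv u≢v = cliques _ bx≢0 _ _ Ku Kv (u≢v ∘ base-injective)
      triangle : ∀ {u v} → q (base u) ≡ q (base x) → q (base v) ≡ q (base x) → x ≢ u → x ≢ v → u ≢ v → ⊥
      triangle Ku Kv x≢u x≢v u≢v =
        spiking-TriangleFree triangle-free _ _ _ (adjacent refl Ku x≢u) (adjacent Ku Kv u≢v) (adjacent refl Kv x≢v)
      three-bases : y' ≢ x' → ⊥
      three-bases y'≢x' with x' ≟ y
      ... | yes refl = triangle (in-K (inj₂ (inj₁ refl))) (in-K (inj₂ (inj₂ (inj₂ refl)))) x≢y (y'≢x ∘ sym) (y'≢x' ∘ sym)
      ... | no x'≢y = triangle (in-K (inj₂ (inj₁ refl))) (in-K (inj₂ (inj₂ (inj₁ refl)))) x≢y (x'≢x ∘ sym) (x'≢y ∘ sym)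
    ... | no bx≢bx' = 4K₁-free (embed₄ S (Part q zero) sx sy sx' sy'
                        (x≢y ∘ spike-injective) (x'≢x ∘ sym ∘ spike-injective) (y'≢x ∘ sym ∘ spike-injective)
                        (y≢x' ∘ spike-injective) (y≢y' ∘ spike-injective) (x'≢y' ∘ spike-injective)
                        (adj-spike-spike x y) (adj-spike-spike x x') (adj-spike-spike x y')
                        (adj-spike-spike y x') (adj-spike-spike y y') (adj-spike-spike x' y'))
      where
      y≢x' : y ≢ x'
      y≢x' refl = bx≢bx' bx≡by
      y≢y' : y ≢ y'
      y≢y' refl = bx≢bx' (trans bx≡by (sym bx'≡by'))

  module _ {x y} (double : Double x y) where

    private
      redirect : ∀ z → Dec (z ≡ x) → Fin (2 + m)
      redirect _ (yes _) = zero
      redirect z (no _) = slot (kind z)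

      lone-inner : ∀ {z} → z ≢ x → (kz : Kind z) → slot kz ≡ zero → ⊥
      lone-inner _ (outer sz) slot≡0 = sz slot≡0
      lone-inner _ (hanging _ bz) slot≡0 = bz slot≡0
      lone-inner {z} z≢x (inner sz bz) _ = with-double double
        where
        with-double : Double x y → ⊥
        with-double (x≢y , sx , sy , bx≢0 , bx≡by) =
          K₂+2K₁-free (embed₄ S (Part q zero) bz sz sx sy
            (base≢spike z z) (base≢spike z x) (base≢spike z y) (z≢x ∘ spike-injective) (z≢y ∘ spike-injective)
            (x≢y ∘ spike-injective) (base-spike-adjacent z) (base-spike-nonadjacent z≢x) (base-spike-nonadjacent z≢y)
            (adj-spike-spike z x) (adj-spike-spike z y) (adj-spike-spike x y))
          where
          z≢y : z ≢ y
          z≢y refl = bx≢0 (trans bx≡by bz)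

      redirected-collision : ∀ {x' y'} → x' ≢ y' → (dx : Dec (x' ≡ x)) (dy : Dec (y' ≡ x)) → redirect x' dx ≡ redirect y' dy → ⊥
      redirected-collision x'≢y' (yes refl) (yes refl) _ = x'≢y' refl
      redirected-collision _ (yes refl) (no y'≢x) same = lone-inner y'≢x (kind _) (sym same)
      redirected-collision _ (no x'≢x) (yes refl) same = lone-inner x'≢x (kind _) same
      redirected-collision x'≢y' (no x'≢x) (no y'≢x) same =
        two-doubles double (collision⇒Double x'≢y' (kind _) (kind _) same) x'≢x y'≢x

    no-double : ⊥
    no-double with pigeonhole (≤-reflexive (sym size)) (λ z → redirect z (z ≟ x))
    ... | x' , y' , x'<y' , same = redirected-collision (<⇒≢ x'<y') (x' ≟ x) (y' ≟ x) same

  cliques-and-free-part-cannot-cover : ⊥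
  cliques-and-free-part-cannot-cover with pigeonhole (≤-reflexive (sym size)) (slot ∘ kind)
  ... | x , y , x<y , same = no-double (collision⇒Double (<⇒≢ x<y) (kind x) (kind y) same)

-- Sufficiency

module _ {T G : Graph} {m : ℕ} (size : n T ≡ 3 + m) (tree : IsTree T) (p : Fin (n G) → Fin (2 + m)) where

  private
    S : Graph
    S = spiking T
    triangle-free : TriangleFree T
    triangle-free = acyclic⇒TriangleFree {T} (proj₂ (proj₂ tree))
    square-free : SquareFree T
    square-free = acyclic⇒SquareFree {T} (proj₂ (proj₂ tree))

  CondI⇒Witnessing : CondI G p → Witnessing S G p
  CondI⇒Witnessing (comatching₀ , j , _ , comatchingⱼ , cliques) q
    with any? (λ i → ¬? (i ≟ zero) ×-dec ¬? (i ≟ j) ×-dec ¬? (Clique? S (Part? q i)))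
  ... | yes (i , i≢0 , i≢j , ¬clique) = i , λ e → ¬clique (Clique-reflect G (Part p i) {S} {Part q i} e (cliques i i≢0 i≢j))
  ... | no no-bad-clique with CoMatching? S (Part? q zero) | CoMatching? S (Part? q j)
  ...   | no ¬comatching | _ = zero , λ e → ¬comatching (CoMatching-reflect G (Part p zero) {S} {Part q zero} e comatching₀)
  ...   | yes _ | no ¬comatching = j , λ e → ¬comatching (CoMatching-reflect G (Part p j) {S} {Part q j} e comatchingⱼ)
  ...   | yes comatching₀′ | yes comatchingⱼ′ =
    ⊥-elim (cliques-and-two-comatchings-cannot-cover T size triangle-free square-free q comatching₀′ comatchingⱼ′
              λ i i≢0 i≢j → decidable-stable (Clique? S (Part? q i)) λ ¬clique → no-bad-clique (i , i≢0 , i≢j , ¬clique))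

  CondII⇒Witnessing : CondII G p → Witnessing S G p
  CondII⇒Witnessing (cliques , components) q with any? (λ i → ¬? (i ≟ zero) ×-dec ¬? (Clique? S (Part? q i)))
  ... | yes (i , i≢0 , ¬clique) = i , λ e → ¬clique (Clique-reflect G (Part p i) {S} {Part q i} e (cliques i i≢0))
  ... | no no-bad-clique = zero , λ e →
    cliques-and-free-part-cannot-cover T size triangle-free q
      (λ i i≢0 → decidable-stable (Clique? S (Part? q i)) λ ¬clique → no-bad-clique (i , i≢0 , ¬clique))
      (λ h → VertexPlusCoMatching⇒4K₁-free G structured (Embeds-trans {4K₁} {S} {G} {Y = Part q zero} {Part p zero} h e))
      (λ h → VertexPlusCoMatching⇒K₂+2K₁-free G structured (Embeds-trans {K₂+2K₁} {S} {G} {Y = Part q zero} {Part p zero} h e))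
      (λ h → VertexPlusCoMatching⇒2K₂-free G structured (Embeds-trans {2K₂} {S} {G} {Y = Part q zero} {Part p zero} h e))
      (P4Free-reflect {S} {Part q zero} {G} {Part p zero} e (VertexPlusCoMatching⇒P4Free G structured))
    where
    structured : EachCoComponent VertexPlusCoMatching G (Part p zero)
    structured u Xu with components u Xu
    ... | inj₁ stable3 = Stable3⇒VertexPlusCoMatching G stable3
    ... | inj₂ vertex+comatching = vertex+comatching

sufficiency : ∀ {T G} → IsSpiked T → (m : ℕ) → IsAlpha T full (3 + m) → (p : Fin (n G) → Fin (2 + m)) →
              Interesting T G p → CondI G p ⊎ CondII G p → Certifying T G p
sufficiency {T} {G} (T' , tree , spiked) m α p (alpha-ordered , clique-or-stable) cond =
  witnessing cond , alpha-ordered , (cliques cond , clique-or-stable zero) , P4-free cond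
  where
  S≅T : spiking T' ≅ T
  S≅T = spiking-≅ {T} {T'} spiked
  size : n T' ≡ 3 + m
  size = sym (alpha-spiking S≅T α)
  3≤|T| : 3 ≤ n T
  3≤|T| = ≤-trans (subst (3 ≤_) (sym size) (s≤s (s≤s (s≤s z≤n)))) (≤-trans (m≤m+n (n T') (n T')) (≅⇒≤ S≅T))
  2≤|T| : 2 ≤ n T
  2≤|T| = ≤-trans (s≤s (s≤s z≤n)) 3≤|T|
  witnessing : CondI G p ⊎ CondII G p → Witnessing T G p
  witnessing (inj₁ condI) = Witnessing-≅ {G = G} {p = p} S≅T (CondI⇒Witnessing {T'} {G} size tree p condI)
  witnessing (inj₂ condII) = Witnessing-≅ {G = G} {p = p} S≅T (CondII⇒Witnessing {T'} {G} size tree p condII)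
  cliques : CondI G p ⊎ CondII G p → ∀ i → i ≢ zero → HasClique G (Part p i) (n T)
  cliques cond i i≢0 with clique-or-stable i
  ... | inj₁ clique = clique
  cliques (inj₁ (_ , j , _ , comatchingⱼ , cliques)) i i≢0 | inj₂ stable with i ≟ j
  ... | yes refl = ⊥-elim (CoMatching⇒¬HasStable G comatchingⱼ 3≤|T| stable)
  ... | no i≢j = ⊥-elim (Clique⇒¬HasStable G (cliques i i≢0 i≢j) 2≤|T| stable)
  cliques (inj₂ (cliques , _)) i i≢0 | inj₂ stable = ⊥-elim (Clique⇒¬HasStable G (cliques i i≢0) 2≤|T| stable)
  P4-free : CondI G p ⊎ CondII G p → ∀ i → P4Free G (Part p i)
  P4-free (inj₁ (comatching₀ , j , _ , comatchingⱼ , cliques)) i with i ≟ zero | i ≟ j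
  ... | yes refl | _ = CoMatching⇒P4Free G comatching₀
  ... | no _ | yes refl = CoMatching⇒P4Free G comatchingⱼ
  ... | no i≢0 | no i≢j = Clique⇒P4Free G (cliques i i≢0 i≢j)
  P4-free (inj₂ (cliques , components)) i with i ≟ zero
  ... | yes refl = VertexPlusCoMatching⇒P4Free G λ u Xu → structured (components u Xu)
    where
    structured : ∀ {C} → Stable3 G C ⊎ VertexPlusCoMatching G C → VertexPlusCoMatching G C
    structured (inj₁ stable3) = Stable3⇒VertexPlusCoMatching G stable3
    structured (inj₂ vertex+comatching) = vertex+comatching
  ... | no i≢0 = Clique⇒P4Free G (cliques i i≢0)

transpose-here : ∀ {N} (a b : Fin N) → transpose a b ⟨$⟩ʳ a ≡ b
transpose-here a b rewrite dec-true (a ≟ a) refl = refl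

transpose-elsewhere : ∀ {N} {a b c : Fin N} → c ≢ a → c ≢ b → transpose a b ⟨$⟩ʳ c ≡ c
transpose-elsewhere {a = a} {b} {c} c≢a c≢b rewrite dec-false (c ≟ a) c≢a | dec-false (c ≟ b) c≢b = refl

permutation-moving : ∀ k {N} (v pos : Fin k → Fin N) → (∀ i j → v i ≡ v j → i ≡ j) → (∀ i j → pos i ≡ pos j → i ≡ j) →
                     Σ (Permutation′ N) λ π → ∀ i → π ⟨$⟩ʳ v i ≡ pos i
permutation-moving ℕ.zero _ _ _ _ = Perm.id , λ ()
permutation-moving (ℕ.suc k) v pos v-inj pos-inj
  with permutation-moving k (v ∘ suc) (pos ∘ suc) (λ i j → suc-injective ∘ v-inj (suc i) (suc j))
                                                  (λ i j → suc-injective ∘ pos-inj (suc i) (suc j))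
... | π , π-moves = π ∘ₚ transpose (π ⟨$⟩ʳ v zero) (pos zero) , moves
  where
  moves : ∀ i → transpose (π ⟨$⟩ʳ v zero) (pos zero) ⟨$⟩ʳ (π ⟨$⟩ʳ v i) ≡ pos i
  moves zero = transpose-here (π ⟨$⟩ʳ v zero) (pos zero)
  moves (suc i) = trans (cong (transpose (π ⟨$⟩ʳ v zero) (pos zero) ⟨$⟩ʳ_) (π-moves i))
    (transpose-elsewhere ((λ ()) ∘ v-inj (suc i) zero ∘ to-injective π ∘ trans (π-moves i)) ((λ ()) ∘ pos-inj (suc i) zero))

injection⇒split : ∀ {k r N} (v : Fin k → Fin N) → (∀ i j → v i ≡ v j → i ≡ j) → N ≡ k + r →
                  Σ (Fin N ↔ (Fin k ⊎ Fin r)) λ e → ∀ i → Inverse.from e (inj₁ i) ≡ v i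
injection⇒split {k} {r} {N} v v-inj N≡k+r with permutation-moving k v position v-inj position-injective
  where
  position : Fin k → Fin N
  position i = cast (sym N≡k+r) (i ↑ˡ r)
  position-injective : ∀ i j → position i ≡ position j → i ≡ j
  position-injective i j eq = ↑ˡ-injective r i j
    (trans (sym (cast-involutive N≡k+r (sym N≡k+r) _)) (trans (cong (cast N≡k+r) eq) (cast-involutive N≡k+r (sym N≡k+r) _)))
... | π , π-moves = +↔⊎ ↔-∘ (cast-id N≡k+r ↔-∘ π) , λ i → trans (cong (π ⟨$⟩ˡ_) (sym (π-moves i))) (inverseˡ π)

-- Splittings of the spiked path

triple : Graph → Graph → Graph → Fin 3 → Graph
triple H₀ H₁ H₂ = H₀ ∷ H₁ ∷ H₂ ∷ []

record Splits (H : Fin 3 → Graph) : Set where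
  constructor splitting
  field
    part : Fin 8 → Fin 3
    piece : ∀ σ → Embeds spikedP₄ (Part part σ) (H σ) full

IsEmbedding : (A : Graph) → VSet (n A) → (B : Graph) → (Fin (n A) → Fin (n B)) → Set
IsEmbedding A X B f = (∀ u v → X u → X v → f u ≡ f v → u ≡ v) × (∀ u v → X u → X v → adj B (f u) (f v) ≡ adj A u v)

isEmbedding? : (A : Graph) {X : VSet (n A)} → (∀ v → Dec (X v)) → (B : Graph) (f : Fin (n A) → Fin (n B)) →
               Dec (IsEmbedding A X B f)
isEmbedding? A X? B f = (all? λ u → all? λ v → X? u →-dec X? v →-dec (f u ≟ f v) →-dec (u ≟ v)) ×-dec
                        (all? λ u → all? λ v → X? u →-dec X? v →-dec (adj B (f u) (f v) ≟ᵇ adj A u v))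

-- The implicit argument makes the type checker verify the three embeddings by evaluation.
split : (H : Fin 3 → Graph) (part : Fin 8 → Fin 3) (place : ∀ σ → Fin 8 → Fin (n (H σ))) →
        {_ : True (all? λ σ → isEmbedding? spikedP₄ (Part? part σ) (H σ) (place σ))} → Splits H
split H part place {embedding} = splitting part λ σ → place σ , (λ _ _ → tt) , toWitness embedding σ

-- Vertices 0–3 of spikedP₄ form the path and 4 + k is the spike at k.
row : ∀ {A : Set} → A → A → A → A → A → A → A → A → Fin 8 → A
row a₀ a₁ a₂ a₃ a₄ a₅ a₆ a₇ = a₀ ∷ a₁ ∷ a₂ ∷ a₃ ∷ a₄ ∷ a₅ ∷ a₆ ∷ a₇ ∷ []

splits-4K₁ : Splits (triple 4K₁ K₂ K₂)
splits-4K₁ = split (triple 4K₁ K₂ K₂) (row 1F 1F 2F 2F 0F 0F 0F 0F)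
  λ { 0F → row 0F 0F 0F 0F 0F 1F 2F 3F ; 1F → row 0F 1F 0F 0F 0F 0F 0F 0F ; 2F → row 0F 0F 0F 1F 0F 0F 0F 0F }

splits-K₂+2K₁ : Splits (triple K₂+2K₁ K₂ K₂)
splits-K₂+2K₁ = split (triple K₂+2K₁ K₂ K₂) (row 0F 1F 1F 2F 0F 0F 0F 2F)
  λ { 0F → row 0F 0F 0F 0F 1F 2F 3F 0F ; 1F → row 0F 0F 1F 0F 0F 0F 0F 0F ; 2F → row 0F 0F 0F 0F 0F 0F 0F 1F }

splits-2K₂ : Splits (triple 2K₂ K₂ K₂)
splits-2K₂ = split (triple 2K₂ K₂ K₂) (row 0F 1F 0F 2F 0F 1F 0F 2F)
  λ { 0F → row 0F 0F 2F 0F 1F 0F 3F 0F ; 1F → row 0F 0F 0F 0F 0F 1F 0F 0F ; 2F → row 0F 0F 0F 0F 0F 0F 0F 1F }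

splits-P₃-K₂+K₁ : Splits (triple P₃ K₂+K₁ K₂)
splits-P₃-K₂+K₁ = split (triple P₃ K₂+K₁ K₂) (row 0F 0F 1F 2F 0F 1F 1F 2F)
  λ { 0F → row 1F 2F 0F 0F 0F 0F 0F 0F ; 1F → row 0F 0F 0F 0F 0F 2F 1F 0F ; 2F → row 0F 0F 0F 0F 0F 0F 0F 1F }

splits-K₂+K₁-P₃ : Splits (triple K₂+K₁ P₃ K₂)
splits-K₂+K₁-P₃ = split (triple K₂+K₁ P₃ K₂) (row 1F 1F 0F 2F 1F 0F 0F 2F)
  λ { 0F → row 0F 0F 0F 0F 0F 2F 1F 0F ; 1F → row 1F 2F 0F 0F 0F 0F 0F 0F ; 2F → row 0F 0F 0F 0F 0F 0F 0F 1F }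

splits-P₃-3K₁ : Splits (triple P₃ 3K₁ K₂)
splits-P₃-3K₁ = split (triple P₃ 3K₁ K₂) (row 0F 0F 0F 2F 1F 1F 1F 2F)
  λ { 0F → row 0F 1F 2F 0F 0F 0F 0F 0F ; 1F → row 0F 0F 0F 0F 0F 1F 2F 0F ; 2F → row 0F 0F 0F 0F 0F 0F 0F 1F }

splits-3K₁-P₃ : Splits (triple 3K₁ P₃ K₂)
splits-3K₁-P₃ = split (triple 3K₁ P₃ K₂) (row 1F 1F 1F 2F 0F 0F 0F 2F)
  λ { 0F → row 0F 0F 0F 0F 0F 1F 2F 0F ; 1F → row 0F 1F 2F 0F 0F 0F 0F 0F ; 2F → row 0F 0F 0F 0F 0F 0F 0F 1F }

splits-K₂+K₁-K₂+K₁ : Splits (triple K₂+K₁ K₂+K₁ K₂)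
splits-K₂+K₁-K₂+K₁ = split (triple K₂+K₁ K₂+K₁ K₂) (row 0F 1F 2F 1F 0F 0F 2F 1F)
  λ { 0F → row 0F 0F 0F 0F 1F 2F 0F 0F ; 1F → row 0F 2F 0F 0F 0F 0F 0F 1F ; 2F → row 0F 0F 0F 0F 0F 0F 1F 0F }

splits-K₂+K₁-3K₁ : Splits (triple K₂+K₁ 3K₁ K₂)
splits-K₂+K₁-3K₁ = split (triple K₂+K₁ 3K₁ K₂) (row 0F 1F 2F 2F 0F 0F 1F 1F)
  λ { 0F → row 0F 0F 0F 0F 1F 2F 0F 0F ; 1F → row 0F 0F 0F 0F 0F 0F 1F 2F ; 2F → row 0F 0F 0F 1F 0F 0F 0F 0F }

splits-3K₁-K₂+K₁ : Splits (triple 3K₁ K₂+K₁ K₂)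
splits-3K₁-K₂+K₁ = split (triple 3K₁ K₂+K₁ K₂) (row 1F 0F 2F 2F 1F 1F 0F 0F)
  λ { 0F → row 0F 0F 0F 0F 0F 0F 1F 2F ; 1F → row 0F 0F 0F 0F 1F 2F 0F 0F ; 2F → row 0F 0F 0F 1F 0F 0F 0F 0F }

splits-3K₁-3K₁ : Splits (triple 3K₁ 3K₁ K₂)
splits-3K₁-3K₁ = split (triple 3K₁ 3K₁ K₂) (row 2F 0F 1F 0F 2F 1F 0F 1F)
  λ { 0F → row 0F 0F 0F 1F 0F 0F 2F 0F ; 1F → row 0F 0F 0F 0F 0F 1F 0F 2F ; 2F → row 0F 0F 0F 0F 1F 0F 0F 0F }

splits-P₃-P₃ : Splits (triple P₃ P₃ 2K₁)
splits-P₃-P₃ = split (triple P₃ P₃ 2K₁) (row 0F 0F 1F 1F 0F 2F 2F 1F)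
  λ { 0F → row 1F 2F 0F 0F 0F 0F 0F 0F ; 1F → row 0F 0F 2F 1F 0F 0F 0F 0F ; 2F → row 0F 0F 0F 0F 0F 0F 1F 0F }

module _ {T G : Graph} {m : ℕ} (path : Embeds P₄ full T full)
         (vertices : Fin (n T) ↔ (Fin 4 ⊎ Fin m)) (vertices-path : ∀ k → Inverse.from vertices (inj₁ k) ≡ proj₁ path k)
         (p : Fin (n G) → Fin (3 + m)) (s : Fin 3 → Fin (3 + m)) (s-injective : ∀ σ τ → s σ ≡ s τ → σ ≡ τ)
         (parts : Fin (3 + m) ↔ (Fin 3 ⊎ Fin m)) (parts-s : ∀ σ → Inverse.from parts (inj₁ σ) ≡ s σ) where

  open Spiking T

  private
    S : Graph
    S = spiking T

    ι : Fin 4 → Fin (n T)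
    ι = proj₁ path

    module V = Inverse vertices
    module P = Inverse parts

    P-from-injective : ∀ {c c'} → P.from c ≡ P.from c' → c ≡ c'
    P-from-injective {c} {c'} eq = trans (sym (P.strictlyInverseˡ c)) (trans (cong P.to eq) (P.strictlyInverseˡ c'))

    on-path : ∀ {x k} → V.to x ≡ inj₁ k → x ≡ ι k
    on-path {x} {k} eq = trans (sym (V.strictlyInverseʳ x)) (trans (cong V.from eq) (vertices-path k))

    OnPath : VSet (n T)
    OnPath x = Σ (Fin 4) λ k → V.to x ≡ inj₁ k

    π₄ : Fin (n T) → Fin 4
    π₄ x = [ id , (λ _ → 0F) ] (V.to x)

    path-embeds : Embeds T OnPath P₄ full
    path-embeds = π₄ , (λ _ _ → tt) , injective , adjacency
      where
      π₄-on-path : ∀ {x k} → V.to x ≡ inj₁ k → π₄ x ≡ k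
      π₄-on-path eq = cong [ id , (λ _ → 0F) ] eq
      injective : ∀ u v → OnPath u → OnPath v → π₄ u ≡ π₄ v → u ≡ v
      injective _ _ (_ , eu) (_ , ev) eq =
        trans (on-path eu) (trans (cong ι (trans (sym (π₄-on-path eu)) (trans eq (π₄-on-path ev)))) (sym (on-path ev)))
      adjacency : ∀ u v → OnPath u → OnPath v → adj P₄ (π₄ u) (π₄ v) ≡ adj T u v
      adjacency _ _ (k , eu) (l , ev) rewrite π₄-on-path eu | π₄-on-path ev | on-path eu | on-path ev =
        sym (proj₂ (proj₂ (proj₂ path)) k l tt tt)

    s≢rest : ∀ σ r → s σ ≢ P.from (inj₂ r)
    s≢rest σ r eq with P-from-injective (trans (parts-s σ) eq)
    ... | ()

  -- The spiked path is distributed as prescribed by part; every other base vertex goes, with its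
  -- spike, to a part of its own.
  module _ (part : Fin 8 → Fin 3) where

    private
      place : Fin (n T + n T) → Fin 4 ⊎ Fin m → Fin (3 + m)
      place w (inj₁ _) = s (part (spikeMap π₄ w))
      place _ (inj₂ r) = P.from (inj₂ r)

    cover : Fin (n T + n T) → Fin (3 + m)
    cover w = place w (V.to (index w))

    cover-path : ∀ σ w → cover w ≡ s σ → OnPath (index w) × Part part σ (spikeMap π₄ w)
    cover-path σ w qw = by-class (V.to (index w)) refl qw
      where
      by-class : ∀ c → V.to (index w) ≡ c → place w c ≡ s σ → OnPath (index w) × Part part σ (spikeMap π₄ w)
      by-class (inj₁ k) eq qw′ = (k , eq) , s-injective _ _ qw′
      by-class (inj₂ r) _ qw′ = ⊥-elim (s≢rest σ r (sym qw′))

    cover-pair : ∀ r w → cover w ≡ P.from (inj₂ r) → index w ≡ V.from (inj₂ r) × full (side w)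
    cover-pair r w qw = by-class (V.to (index w)) refl qw , tt
      where
      by-class : ∀ c → V.to (index w) ≡ c → place w c ≡ P.from (inj₂ r) → index w ≡ V.from (inj₂ r)
      by-class (inj₁ _) _ qw′ = ⊥-elim (s≢rest _ r qw′)
      by-class (inj₂ r′) eq qw′ with P-from-injective qw′
      ... | refl = trans (sym (V.strictlyInverseʳ (index w))) (cong V.from eq)

    cover-embeds : (∀ σ → Embeds spikedP₄ (Part part σ) G (Part p (s σ))) →
                   (∀ i → (∀ σ → i ≢ s σ) → Embeds K₂ full G (Part p i)) → ∀ i → Embeds S (Part cover i) G (Part p i)
    cover-embeds pieces edges i = by-part (P.to i) refl
      where
      path-part : ∀ σ → Embeds S (Part cover (s σ)) G (Part p (s σ))
      path-part σ = Embeds-trans {S} {spikedP₄} {G} {Part cover (s σ)} {Part part σ} {Part p (s σ)}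
        (Embeds-restrict {S} {spikedP₄} {OnPath ∘ index} {Part cover (s σ)} {full} {Part part σ} (spiking-embeds {T} {P₄} {OnPath} {full} path-embeds) (cover-path σ))
        (pieces σ)
      pair-part : ∀ r → Embeds S (Part cover (P.from (inj₂ r))) G (Part p (P.from (inj₂ r)))
      pair-part r = Embeds-trans {S} {K₂} {G} {Part cover (P.from (inj₂ r))} {full} {Part p (P.from (inj₂ r))}
        (Embeds-restrict {S} {K₂} {λ w → index w ≡ V.from (inj₂ r)} {Part cover (P.from (inj₂ r))} {full} {full} (pair-embeds (V.from (inj₂ r))) (cover-pair r))
        (edges _ λ σ eq → s≢rest σ r (sym eq))
      at : ∀ {c} → P.to i ≡ c → i ≡ P.from c
      at eq = trans (sym (P.strictlyInverseʳ i)) (cong P.from eq)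
      by-part : ∀ c → P.to i ≡ c → Embeds S (Part cover i) G (Part p i)
      by-part (inj₁ σ) eq = subst (λ j → Embeds S (Part cover j) G (Part p j)) (sym (trans (at eq) (parts-s σ))) (path-part σ)
      by-part (inj₂ r) eq = subst (λ j → Embeds S (Part cover j) G (Part p j)) (sym (at eq)) (pair-part r)

  splitting⇒¬Witnessing : ∀ {H} → Splits H → (∀ σ → Embeds (H σ) full G (Part p (s σ))) →
                          (∀ i → (∀ σ → i ≢ s σ) → Embeds K₂ full G (Part p i)) → ¬ Witnessing S G p
  splitting⇒¬Witnessing {H} (splitting part splits) pieces edges witnessing with witnessing (cover part)
  ... | i , ¬embeds = ¬embeds (cover-embeds part (λ σ → Embeds-trans {spikedP₄} {H σ} {G} {Part part σ} {full} {Part p (s σ)} (splits σ) (pieces σ)) edges i)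

-- Necessity

data Triad : Set where
  p₃ k₂+k₁ 3k₁ : Triad

triad : Triad → Graph
triad p₃ = P₃
triad k₂+k₁ = K₂+K₁
triad 3k₁ = 3K₁

splits-triads : ∀ a b → (a ≡ p₃ → b ≡ p₃ → ⊥) → Splits (triple (triad a) (triad b) K₂)
splits-triads p₃ p₃ not-both = ⊥-elim (not-both refl refl)
splits-triads p₃ k₂+k₁ _ = splits-P₃-K₂+K₁
splits-triads p₃ 3k₁ _ = splits-P₃-3K₁
splits-triads k₂+k₁ p₃ _ = splits-K₂+K₁-P₃
splits-triads k₂+k₁ k₂+k₁ _ = splits-K₂+K₁-K₂+K₁
splits-triads k₂+k₁ 3k₁ _ = splits-K₂+K₁-3K₁
splits-triads 3k₁ p₃ _ = splits-3K₁-P₃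
splits-triads 3k₁ k₂+k₁ _ = splits-3K₁-K₂+K₁
splits-triads 3k₁ 3k₁ _ = splits-3K₁-3K₁

TriadIn : (G : Graph) → VSet (n G) → Set
TriadIn G X = Σ Triad λ t → Embeds (triad t) full G X × (CoMatching G X → t ≡ p₃)

module _ (G : Graph) {X : VSet (n G)} where

  non-comatching-triad : ∀ {a b c} → X a → X b → X c → a ≢ b → a ≢ c → b ≢ c → NonAdj G a b → NonAdj G a c →
                         Σ Triad λ t → t ≢ p₃ × Embeds (triad t) full G X
  non-comatching-triad {a} {b} {c} Xa Xb Xc a≢b a≢c b≢c ab ac with Adj⊎NonAdj G b c
  ... | inj₁ bc = k₂+k₁ , (λ ()) , embed₃ G X Xb Xc Xa b≢c (a≢b ∘ sym) (a≢c ∘ sym) bc (NonAdj-sym G ab) (NonAdj-sym G ac)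
  ... | inj₂ bc = 3k₁ , (λ ()) , embed₃ G X Xa Xb Xc a≢b a≢c b≢c ab ac bc

  non-edge-triad : ∀ {u v} → X u → X v → u ≢ v → NonAdj G u v → HasClique G X 3 → TriadIn G X
  non-edge-triad {u} {v} Xu Xv u≢v uv (f , f-inj , fX , _)
    with any? (λ i → ¬? (f i ≟ u) ×-dec ¬? (f i ≟ v))
  ... | no all-in = ⊥-elim (three-into-two f f-inj λ i → in-uv i)
    where
    in-uv : ∀ i → f i ≡ u ⊎ f i ≡ v
    in-uv i with f i ≟ u | f i ≟ v
    ... | yes fi≡u | _ = inj₁ fi≡u
    ... | no _ | yes fi≡v = inj₂ fi≡v
    ... | no fi≢u | no fi≢v = ⊥-elim (all-in (i , fi≢u , fi≢v))
  ... | yes (i , k≢u , k≢v) with Adj⊎NonAdj G (f i) u | Adj⊎NonAdj G (f i) v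
  ...   | inj₁ ku | inj₁ kv = p₃ , embed₃ G X Xu (fX i) Xv (k≢u ∘ sym) u≢v k≢v (Adj-sym G ku) uv kv , λ _ → refl
  ...   | inj₁ ku | inj₂ kv = k₂+k₁ , embed₃ G X (fX i) Xu Xv k≢u k≢v u≢v ku kv uv ,
                              λ comatching → ⊥-elim (k≢u (sym (comatching v u (f i) Xv Xu (fX i) (u≢v ∘ sym) (k≢v ∘ sym) (NonAdj-sym G uv) (NonAdj-sym G kv))))
  ...   | inj₂ ku | inj₁ kv = k₂+k₁ , embed₃ G X (fX i) Xv Xu k≢v k≢u (u≢v ∘ sym) kv ku (NonAdj-sym G uv) ,
                              λ comatching → ⊥-elim (k≢v (sym (comatching u v (f i) Xu Xv (fX i) u≢v (k≢u ∘ sym) uv (NonAdj-sym G ku))))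
  ...   | inj₂ ku | inj₂ kv = 3k₁ , embed₃ G X Xu Xv (fX i) u≢v (k≢u ∘ sym) (k≢v ∘ sym) uv (NonAdj-sym G ku) (NonAdj-sym G kv) ,
                              λ comatching → ⊥-elim (k≢v (sym (comatching u v (f i) Xu Xv (fX i) u≢v (k≢u ∘ sym) uv (NonAdj-sym G ku))))

parts₃ : ∀ {m} → Fin (3 + m) → Fin (3 + m) → Fin 3 → Fin (3 + m)
parts₃ _ _ 0F = zero
parts₃ j _ 1F = j
parts₃ _ l 2F = l

parts₃-injective : ∀ {m} {j l : Fin (3 + m)} → j ≢ zero → l ≢ zero → j ≢ l → ∀ σ τ → parts₃ j l σ ≡ parts₃ j l τ → σ ≡ τ
parts₃-injective {j = j} {l} j≢0 l≢0 j≢l = injective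
  where
  injective : ∀ σ τ → parts₃ j l σ ≡ parts₃ j l τ → σ ≡ τ
  injective 0F 0F _ = refl
  injective 0F 1F eq = ⊥-elim (j≢0 (sym eq))
  injective 0F 2F eq = ⊥-elim (l≢0 (sym eq))
  injective 1F 0F eq = ⊥-elim (j≢0 eq)
  injective 1F 1F _ = refl
  injective 1F 2F eq = ⊥-elim (j≢l eq)
  injective 2F 0F eq = ⊥-elim (l≢0 eq)
  injective 2F 1F eq = ⊥-elim (j≢l (sym eq))
  injective 2F 2F _ = refl

another-part : ∀ {m} (j : Fin (3 + m)) → Σ (Fin (3 + m)) λ l → l ≢ zero × j ≢ l
another-part 0F = 1F , (λ ()) , (λ ())
another-part 1F = 2F , (λ ()) , (λ ())
another-part (suc (suc _)) = 1F , (λ ()) , (λ ())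

module _ {T G : Graph} {m : ℕ} (path : Embeds P₄ full T full)
         (vertices : Fin (n T) ↔ (Fin 4 ⊎ Fin m)) (vertices-path : ∀ k → Inverse.from vertices (inj₁ k) ≡ proj₁ path k)
         (p : Fin (n G) → Fin (3 + m)) (witnessing : Witnessing (spiking T) G p)
         (cliques : ∀ i → i ≢ zero → HasClique G (Part p i) 3) where

  private
    X : Fin (3 + m) → VSet (n G)
    X = Part p

    edge : ∀ i → i ≢ zero → Embeds K₂ full G (X i)
    edge i i≢0 = clique⇒embeds G (X i) (HasClique-≤ G (X i) (s≤s (s≤s z≤n)) (cliques i i≢0))

  excluded : ∀ {H} → Splits H → ∀ {j l} → j ≢ zero → l ≢ zero → j ≢ l →
             Embeds (H 0F) full G (X zero) → Embeds (H 1F) full G (X j) → Embeds (H 2F) full G (X l) → ⊥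
  excluded {H} splits {j} {l} j≢0 l≢0 j≢l e₀ e₁ e₂ with injection⇒split (parts₃ j l) (parts₃-injective j≢0 l≢0 j≢l) refl
  ... | parts , parts-s =
    splitting⇒¬Witnessing {T} {G} path vertices vertices-path p (parts₃ j l) (parts₃-injective j≢0 l≢0 j≢l) parts parts-s {H} splits pieces
      (λ i i∉ → edge i (i∉ 0F)) witnessing
    where
    pieces : ∀ σ → Embeds (H σ) full G (X (parts₃ j l σ))
    pieces 0F = e₀
    pieces 1F = e₁
    pieces 2F = e₂

  part₀-4K₁-free : Free 4K₁ G (X zero)
  part₀-4K₁-free e = excluded splits-4K₁ {1F} {2F} (λ ()) (λ ()) (λ ()) e (edge 1F (λ ())) (edge 2F (λ ()))

  part₀-K₂+2K₁-free : Free K₂+2K₁ G (X zero)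
  part₀-K₂+2K₁-free e = excluded splits-K₂+2K₁ {1F} {2F} (λ ()) (λ ()) (λ ()) e (edge 1F (λ ())) (edge 2F (λ ()))

  part₀-2K₂-free : Free 2K₂ G (X zero)
  part₀-2K₂-free e = excluded splits-2K₂ {1F} {2F} (λ ()) (λ ()) (λ ()) e (edge 1F (λ ())) (edge 2F (λ ()))

  module _ (α-ordered : ∀ j a b → IsAlpha G (X zero) a → IsAlpha G (X j) b → b ≤ a)
           (clique₀ : HasClique G (X zero) 3) (P4-free₀ : P4Free G (X zero)) where

    CondII-case : (∀ i → i ≢ zero → Clique G (X i)) → CondII G p
    CondII-case cliques′ = cliques′ , λ u Xu →
      inj₂ (free⇒VertexPlusCoMatching G (Part? p zero) part₀-4K₁-free part₀-K₂+2K₁-free part₀-2K₂-free P4-free₀ u Xu)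

    part₀-non-edge : ∀ {j u v} → X j u → X j v → u ≢ v → NonAdj G u v →
                     Σ (Fin (n G)) λ u₀ → Σ (Fin (n G)) λ v₀ → X zero u₀ × X zero v₀ × u₀ ≢ v₀ × NonAdj G u₀ v₀
    part₀-non-edge {j} Xu Xv u≢v uv with α-exists G (Part? p zero) | α-exists G (Part? p j)
    ... | a , α₀ | b , αⱼ with HasStable-≤ G (X zero) (≤-trans (proj₂ αⱼ 2 (non-edge⇒HasStable₂ G Xu Xv u≢v uv)) (α-ordered j a b α₀ αⱼ)) (proj₁ α₀)
    ...   | f , f-inj , fX , f-stable = f 0F , f 1F , fX 0F , fX 1F , (λ ()) ∘ f-inj 0F 1F , f-stable 0F 1F

    CondI-case : ∀ {j u v} → j ≢ zero → X j u → X j v → u ≢ v → NonAdj G u v → CondI G p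
    CondI-case {j} j≢0 Xu Xv u≢v uv with part₀-non-edge Xu Xv u≢v uv | another-part j
    ... | _ , _ , Xu₀ , Xv₀ , u₀≢v₀ , u₀v₀ | l , l≢0 , j≢l = comatching₀ , j , j≢0 , comatchingⱼ , others
      where
      triad₀ : TriadIn G (X zero)
      triad₀ = non-edge-triad G Xu₀ Xv₀ u₀≢v₀ u₀v₀ clique₀
      triadⱼ : TriadIn G (X j)
      triadⱼ = non-edge-triad G Xu Xv u≢v uv (HasClique-≤ G (X j) ≤-refl (cliques j j≢0))
      comatching₀ : CoMatching G (X zero)
      comatching₀ a b c Xa Xb Xc a≢b a≢c ab ac with b ≟ c
      ... | yes b≡c = b≡c
      ... | no b≢c with non-comatching-triad G Xa Xb Xc a≢b a≢c b≢c ab ac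
      ...   | t , t≢p₃ , e = ⊥-elim (excluded (splits-triads t (proj₁ triadⱼ) λ t≡p₃ _ → t≢p₃ t≡p₃) j≢0 l≢0 j≢l
                                    e (proj₁ (proj₂ triadⱼ)) (edge l l≢0))
      comatchingⱼ : CoMatching G (X j)
      comatchingⱼ a b c Xa Xb Xc a≢b a≢c ab ac with b ≟ c
      ... | yes b≡c = b≡c
      ... | no b≢c with non-comatching-triad G Xa Xb Xc a≢b a≢c b≢c ab ac
      ...   | t , t≢p₃ , e = ⊥-elim (excluded (splits-triads (proj₁ triad₀) t λ _ t≡p₃ → t≢p₃ t≡p₃) j≢0 l≢0 j≢l
                                    (proj₁ (proj₂ triad₀)) e (edge l l≢0))
      path-in : ∀ {i} → CoMatching G (X i) → TriadIn G (X i) → Embeds P₃ full G (X i)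
      path-in {i} comatching (t , e , t≡p₃) = subst (λ t → Embeds (triad t) full G (X i)) (t≡p₃ comatching) e
      others : ∀ i → i ≢ zero → i ≢ j → Clique G (X i)
      others i i≢0 i≢j a b Xa Xb a≢b with Adj⊎NonAdj G a b
      ... | inj₁ ab = ab
      ... | inj₂ ab = ⊥-elim (excluded splits-P₃-P₃ j≢0 i≢0 (i≢j ∘ sym) (path-in comatching₀ triad₀) (path-in comatchingⱼ triadⱼ)
                                (stable⇒embeds G (X i) (non-edge⇒HasStable₂ G Xa Xb a≢b ab)))

    witnessing⇒CondI⊎CondII : CondI G p ⊎ CondII G p
    witnessing⇒CondI⊎CondII with any? (λ j → any? λ u → any? λ v → ¬? (j ≟ zero) ×-dec Part? p j u ×-dec Part? p j v ×-dec
                                                                 ¬? (u ≟ v) ×-dec (adj G u v ≟ᵇ false))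
    ... | yes (_ , _ , _ , j≢0 , Xu , Xv , u≢v , uv) = inj₁ (CondI-case j≢0 Xu Xv u≢v uv)
    ... | no no-non-edge = inj₂ (CondII-case λ i i≢0 u v Xu Xv u≢v → adjacent i≢0 Xu Xv u≢v)
      where
      adjacent : ∀ {i u v} → i ≢ zero → X i u → X i v → u ≢ v → Adj G u v
      adjacent {i} {u} {v} i≢0 Xu Xv u≢v with Adj⊎NonAdj G u v
      ... | inj₁ uv = uv
      ... | inj₂ uv = ⊥-elim (no-non-edge (i , u , v , i≢0 , Xu , Xv , u≢v , uv))

spiked-nonstar-base : ∀ {T a} → IsSpiked T → ¬ IsSpikedStar T → IsAlpha T full a →
                      Σ Graph λ T' → spiking T' ≅ T × n T' ≡ a × Embeds P₄ full T' full
spiked-nonstar-base {T} (T' , tree , spiked) ¬spiked-star α =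
  T' , spiking-≅ {T} {T'} spiked , sym (alpha-spiking {T} {T'} (spiking-≅ {T} {T'} spiked) α) ,
  nonstar⇒P₄ {T'} tree (λ star → ¬spiked-star (T' , star , spiked))

necessity : ∀ {T G} → IsSpiked T → ¬ IsSpikedStar T → (m : ℕ) → IsAlpha T full (3 + m) →
            (p : Fin (n G) → Fin (2 + m)) → Certifying T G p → CondI G p ⊎ CondII G p
necessity {T} spiked ¬spiked-star m α p certifying with spiked-nonstar-base {T} spiked ¬spiked-star α
necessity {T} spiked ¬spiked-star ℕ.zero α p certifying | T' , S≅T , refl , (ι , _ , ι-inj , _)
  with injective⇒≤ {f = ι} (λ {i} {j} → ι-inj i j tt tt)
... | s≤s (s≤s (s≤s ()))
necessity {T} {G} spiked ¬spiked-star (ℕ.suc m) α p (witnessing , α-ordered , (cliques , clique-or-stable₀) , P4-free)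
  | T' , S≅T , |T'| , path@(ι , _ , ι-inj , _)
  with injection⇒split ι (λ i j → ι-inj i j tt tt) |T'|
... | vertices , vertices-path = witnessing⇒CondI⊎CondII {T'} {G} path vertices vertices-path p S-witnessing cliques₃ α-ordered clique₀ (P4-free zero)
  where
  S-witnessing : Witnessing (spiking T') G p
  S-witnessing = Witnessing-≅ {G = G} {p = p} (≅-sym S≅T) witnessing
  4≤|T| : 4 ≤ n T
  4≤|T| = ≤-trans (subst (4 ≤_) (sym |T'|) (s≤s (s≤s (s≤s (s≤s z≤n))))) (≤-trans (m≤m+n (n T') (n T')) (≅⇒≤ S≅T))
  3≤|T| : 3 ≤ n T
  3≤|T| = ≤-trans (s≤s (s≤s (s≤s z≤n))) 4≤|T|
  cliques₃ : ∀ i → i ≢ zero → HasClique G (Part p i) 3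
  cliques₃ i i≢0 = HasClique-≤ G (Part p i) 3≤|T| (cliques i i≢0)
  clique₀ : HasClique G (Part p zero) 3
  clique₀ = not-stable clique-or-stable₀
    where
    not-stable : HasClique G (Part p zero) (n T) ⊎ HasStable G (Part p zero) (n T) → HasClique G (Part p zero) 3
    not-stable (inj₁ clique) = HasClique-≤ G (Part p zero) 3≤|T| clique
    not-stable (inj₂ stable) = ⊥-elim (part₀-4K₁-free {T'} {G} path vertices vertices-path p S-witnessing cliques₃
                                (stable⇒4K₁ G {Part p zero} (HasStable-≤ G (Part p zero) 4≤|T| stable)))

mainTheorem14 : (T G : Graph) → IsSpiked T → ¬ IsSpikedStar T →
                (m : ℕ) → IsAlpha T full (3 + m) →
                (p : Fin (n G) → Fin (2 + m)) → Interesting T G p →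
                (Certifying T G p ⇔ (CondI G p ⊎ CondII G p))
mainTheorem14 T G spiked ¬spiked-star m α p interesting =
  mk⇔ (necessity {T} {G} spiked ¬spiked-star m α p) (sufficiency {T} {G} spiked m α p interesting)
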